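{- Let $n$ be an even positive integer, let $M$ be a partial matching of $K_n$ covering $2d$ vertices, and let $d\le k\le n/2$. Then $$x_M\equiv_{(\mathcal P_n,k)}\frac{1}{\binom{n/2-d}{k-d}}\sum_{M'\supseteq M,\ |M'|=k}x_{M'},$$ the sum ranging over partial matchings $M'$ of $K_n$ with $k$ edges containing $M$.
   Context: Variables $x_{uv}$ are indexed by edges of $K_n$; for a partial matching $M$, $x_M=\prod_{e\in M}x_e$. $\mathcal P_n=\{x_{uv}x_{uw}: u,v,w\text{ distinct}\}\cup\{\sum_{u\ne v}x_{uv}-1: v\in[n]\}\cup\{x_{uv}^2-x_{uv}\}$. $F\equiv_{(\mathcal P,d)}G$ means there exist polynomials $q(p)$ with $F+\sum_p q(p)p=G$ and $\max_p\deg(q(p)p)\le d$. -}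

module Defs where

open import Data.Nat using (ℕ; zero; suc; _≤_)
import Data.Nat as ℕ
open import Data.Nat.Combinatorics using (_C_)
open import Data.Integer using (+_)
open import Data.Rational using (ℚ; 0ℚ; 1ℚ; _+_; _*_; -_; _/_)
open import Data.Fin using (Fin; _<_)
import Data.Fin as Fin
open import Data.Fin.Properties using (_<?_)
import Data.Fin.Properties as FinP
open import Data.Product using (Σ; ∃; _×_; _,_; proj₁; proj₂)
import Data.Product.Properties as ProdP
open import Data.Product using () renaming (_×_ to _×′_)
open import Relation.Nullary.Decidable using (_×-dec_; ¬?; does; yes; no)
open import Relation.Nullary using (¬_)
open import Relation.Binary.PropositionalEquality using (_≡_; _≢_)
open import Relation.Binary.Definitions using (DecidableEquality)
open import Data.List using (List; []; _∷_; _++_; map; concat; concatMap; foldr; filter; length; allFin)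
open import Data.List.Relation.Unary.All using (All)
import Data.List.Relation.Unary.All as All
open import Data.List.Relation.Unary.AllPairs using (AllPairs; allPairs?)
open import Data.Bool using (if_then_else_)

-- Edges of K_n.  An edge {u,v} is represented canonically by the
-- ordered pair (u , v) with u < v.

Edge : ℕ → Set
Edge n = Fin n × Fin n

_≟ₑ_ : ∀ {n} → DecidableEquality (Edge n)
_≟ₑ_ = ProdP.≡-dec FinP._≟_ FinP._≟_

edge : ∀ {n} → Fin n → Fin n → Edge n
edge u v = if does (u <? v) then (u , v) else (v , u)

allEdges : ∀ n → List (Edge n)
allEdges n = filter (λ e → proj₁ e <? proj₂ e)
                    (concatMap (λ u → map (λ v → (u , v)) (allFin n)) (allFin n))

-- Polynomials over ℚ in the variables x_e, e an edge of K_n.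
-- A monomial is an exponent vector; only the entries m u v with u < v
-- are meaningful (the others are ignored by equality and degree).

Mon : ℕ → Set
Mon n = Fin n → Fin n → ℕ

_≈ₘ_ : ∀ {n} → Mon n → Mon n → Set
_≈ₘ_ {n} m m′ = All (λ e → m (proj₁ e) (proj₂ e) ≡ m′ (proj₁ e) (proj₂ e)) (allEdges n)

_≈ₘ?_ : ∀ {n} (m m′ : Mon n) → Relation.Nullary.Decidable.Dec (m ≈ₘ m′)
m ≈ₘ? m′ = All.all? (λ e → m (proj₁ e) (proj₂ e) ℕ.≟ m′ (proj₁ e) (proj₂ e)) _

deg : ∀ {n} → Mon n → ℕ
deg {n} m = Data.Nat.ListAction.sum (map (λ e → m (proj₁ e) (proj₂ e)) (allEdges n))
  where import Data.Nat.ListAction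

unitMon : ∀ {n} → Mon n
unitMon _ _ = 0

_·ₘ_ : ∀ {n} → Mon n → Mon n → Mon n
(m ·ₘ m′) u v = m u v ℕ.+ m′ u v

varMon : ∀ {n} → Edge n → Mon n
varMon (u , v) a b =
  if does (u FinP.≟ a) then (if does (v FinP.≟ b) then 1 else 0) else 0

Poly : ℕ → Set
Poly n = List (ℚ × Mon n)

coeff : ∀ {n} → Poly n → Mon n → ℚ
coeff [] m = 0ℚ
coeff ((c , m′) ∷ p) m =
  if does (m′ ≈ₘ? m) then c + coeff p m else coeff p m

_≈ₚ_ : ∀ {n} → Poly n → Poly n → Set
p ≈ₚ q = ∀ m → coeff p m ≡ coeff q m

-- deg p ≤ d  (the zero polynomial has every degree bound)
DegLe : ∀ {n} → Poly n → ℕ → Set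
DegLe p d = ∀ m → coeff p m ≢ 0ℚ → deg m ≤ d

0ₚ : ∀ {n} → Poly n
0ₚ = []

1ₚ : ∀ {n} → Poly n
1ₚ = (1ℚ , unitMon) ∷ []

const : ∀ {n} → ℚ → Poly n
const c = (c , unitMon) ∷ []

_+ₚ_ : ∀ {n} → Poly n → Poly n → Poly n
_+ₚ_ = _++_

_*ₚ_ : ∀ {n} → Poly n → Poly n → Poly n
p *ₚ q = concatMap (λ s → map (λ t → (proj₁ s * proj₁ t , proj₂ s ·ₘ proj₂ t)) q) p

scale : ∀ {n} → ℚ → Poly n → Poly n
scale c p = map (λ t → (c * proj₁ t , proj₂ t)) p

-ₚ_ : ∀ {n} → Poly n → Poly n
-ₚ p = scale (- 1ℚ) p

sumₚ : ∀ {n} → List (Poly n) → Poly n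
sumₚ = foldr _+ₚ_ 0ₚ

-- the variable x_{uv} (u ≠ v), identified with x_{vu}
x : ∀ {n} → Fin n → Fin n → Poly n
x u v = (1ℚ , varMon (edge u v)) ∷ []

xM : ∀ {n} → List (Edge n) → Poly n
xM M = foldr (λ e p → x (proj₁ e) (proj₂ e) *ₚ p) 1ₚ M

data Axiom (n : ℕ) : Set where
  disj : (u v w : Fin n) → u ≢ v → u ≢ w → v ≢ w → Axiom n
  cover : (v : Fin n) → Axiom n
  bool : (u v : Fin n) → u ≢ v → Axiom n

axiomPoly : ∀ {n} → Axiom n → Poly n
axiomPoly (disj u v w _ _ _) = x u v *ₚ x u w
axiomPoly {n} (cover v) =
  sumₚ (map (λ u → x u v) (filter (λ u → ¬? (u FinP.≟ v)) (allFin n)))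
    +ₚ (-ₚ 1ₚ)
axiomPoly (bool u v _) = (x u v *ₚ x u v) +ₚ (-ₚ x u v)

-- F ≡_(P_n , d) G : there are polynomials q(p) (p ∈ P_n) with
-- F + Σ_p q(p) p = G and deg(q(p) p) ≤ d for every p.
-- The family q is given as a finite list of pairs (q , p); repeated
-- axioms are allowed (this is equivalent, summing their multipliers).
DerivEq : ∀ n → ℕ → Poly n → Poly n → Set
DerivEq n d F G =
  Σ (List (Poly n × Axiom n)) λ qs →
    (F +ₚ sumₚ (map (λ qa → proj₁ qa *ₚ axiomPoly (proj₂ qa)) qs)) ≈ₚ G
    ×′ All (λ qa → DegLe (proj₁ qa *ₚ axiomPoly (proj₂ qa)) d) qs

IsEdge : ∀ {n} → Edge n → Set
IsEdge (u , v) = u < v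

VertexDisjoint : ∀ {n} → Edge n → Edge n → Set
VertexDisjoint (a , b) (c , d) = (a ≢ c) × (a ≢ d) × (b ≢ c) × (b ≢ d)

VertexDisjoint? : ∀ {n} (e f : Edge n) → Relation.Nullary.Decidable.Dec (VertexDisjoint e f)
VertexDisjoint? (a , b) (c , d) =
  ¬? (a FinP.≟ c) ×-dec ¬? (a FinP.≟ d) ×-dec ¬? (b FinP.≟ c) ×-dec ¬? (b FinP.≟ d)

IsMatching : ∀ {n} → List (Edge n) → Set
IsMatching M = All IsEdge M × AllPairs VertexDisjoint M

IsMatching? : ∀ {n} (M : List (Edge n)) → Relation.Nullary.Decidable.Dec (IsMatching M)
IsMatching? M = All.all? (λ e → proj₁ e <? proj₂ e) M ×-dec allPairs? VertexDisjoint? M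

_⊆ₑ_ : ∀ {n} → List (Edge n) → List (Edge n) → Set
M ⊆ₑ M′ = All (λ e → Data.List.Membership.Propositional._∈_ e M′) M
  where import Data.List.Membership.Propositional

_⊆ₑ?_ : ∀ {n} (M M′ : List (Edge n)) → Relation.Nullary.Decidable.Dec (M ⊆ₑ M′)
M ⊆ₑ? M′ = All.all? (λ e → Data.List.Membership.DecPropositional._∈?_ _≟ₑ_ e M′) M
  where import Data.List.Membership.DecPropositional

sublists : ∀ {A : Set} → List A → List (List A)
sublists [] = [] ∷ []
sublists (a ∷ as) = sublists as ++ map (a ∷_) (sublists as)

-- all partial matchings M′ of K_n with k edges containing M
-- (each edge set listed exactly once)
extensions : ∀ n → List (Edge n) → ℕ → List (List (Edge n))
extensions n M k =
  filter (λ M′ → IsMatching? M′ ×-dec (M ⊆ₑ? M′) ×-dec (length M′ ℕ.≟ k))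
         (sublists (allEdges n))

extSum : ∀ n → List (Edge n) → ℕ → Poly n
extSum n M k = sumₚ (map xM (extensions n M k))

-- 1 / m  (as a rational number; only used for m > 0, 1/0 := 0)
recip : ℕ → ℚ
recip zero = 0ℚ
recip (suc m) = (+ 1) / suc m

module Submission where

-- Base (k = d): M is the only k-edge matching containing M, so the sum is x_M.
-- Step (d < k): with r = 1/(h−d) the certificate (r/2)·x_M·Σ_v (Σ_u x_{uv} − 1) gives
--   x_M ≡_k r · Σ_{e disjoint from M} x_{M+e}                          (one-edge step)
-- (the Boolean axiom turns x_M x_e into x_M for e ∈ M, a disjointness axiom kills x_M x_e
-- for e meeting M, and n = 2h makes the x_M terms cancel).  The induction hypothesis
-- rewrites each x_{M+e}; each k-edge extension of M arises from exactly k − d edges e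
-- (double counting), and (k−d)·C(h−d, k−d) = (h−d)·C(h−d−1, k−d−1) closes the step.

open import Defs
open import Data.Nat using (ℕ; _*_; _≤_; _∸_)
open import Data.Nat.Combinatorics using (_C_)
open import Data.List using (List; length)
open import Relation.Binary.PropositionalEquality using (_≡_)

open import Algebra.Bundles using (CommutativeRing)
open import Algebra.Structures using (IsCommutativeMonoid)
import Data.Bool.Properties
open import Data.Bool using (Bool; true; false; if_then_else_; _∧_)
open import Data.Empty using (⊥-elim)
open import Data.Fin using (Fin; _<_)
open import Data.Fin.Properties using (_<?_)
import Data.Fin.Properties as FinP
open import Data.Integer using (+_)
import Data.List
open import Data.List using ([]; _∷_; _++_; map; concat; concatMap; foldr; filter; filterᵇ; allFin)
open import Data.List.Membership.Propositional using (_∈_; _∉_; _─_; find)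
import Data.List.Membership.Propositional.Properties as ∈P
import Data.List.Membership.DecPropositional
open import Data.List.Relation.Unary.All using (All; []; _∷_)
import Data.List.Relation.Unary.All as All
import Data.List.Relation.Unary.All.Properties as AllP
open import Data.List.Relation.Unary.AllPairs using (AllPairs; []; _∷_)
import Data.List.Relation.Unary.AllPairs as AllPairs
open import Data.List.Relation.Unary.Any using (here; there)
open import Data.List.Relation.Unary.Unique.Propositional using (Unique)
import Data.List.Relation.Unary.Unique.Propositional.Properties as UniqueP
import Data.List.Properties as ListP
open import Data.Nat as N using (zero; suc)
import Data.Nat.Properties as NP
import Data.Nat.ListAction
open import Data.Nat.Combinatorics using (nCk+nC[k+1]≡[n+1]C[k+1]; nC1≡n; k>n⇒nCk≡0)
open import Data.Product using (∃; _×_; _,_; proj₁; proj₂)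
open import Data.Rational using (ℚ; 0ℚ; 1ℚ)
  renaming (_+_ to _+q_; _*_ to _*q_; -_ to -q_; _-_ to _-q_)
import Data.Rational
import Data.Rational.Properties as QP
import Data.Rational.Unnormalised as ℚᵘ
import Data.Rational.Unnormalised.Properties as ℚᵘP
open import Data.Integer.Solver using () renaming (module +-*-Solver to ℤSolver)
open import Data.Rational.Solver using (module +-*-Solver)
open import Data.Sum using (_⊎_; inj₁; inj₂)
open import Function using (_∘_; mk⇔)
open import Relation.Binary.Definitions using (DecidableEquality; tri<; tri≈; tri>)
open import Relation.Binary.PropositionalEquality
  using (_≢_; refl; sym; trans; cong; cong₂; subst; module ≡-Reasoning)
open import Relation.Nullary using (¬_; Dec; yes; no; does; ¬?)
open import Relation.Nullary.Decidable using (dec-true; dec-false; does-⇔; _×-dec_)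
open import Algebra.Properties.Semiring.Mult (CommutativeRing.semiring QP.+-*-commutativeRing)
  using (×-homo-+; ×1-homo-*) renaming (_×_ to _×ℚ_)

module ListSum {C : Set} {_⊕_ : C → C → C} {ε : C}
               (isCM : IsCommutativeMonoid _≡_ _⊕_ ε) where
  open IsCommutativeMonoid isCM using (assoc; comm; identityˡ)
  open ≡-Reasoning

  ∑ : {A : Set} → List A → (A → C) → C
  ∑ [] f = ε
  ∑ (a ∷ as) f = f a ⊕ ∑ as f

  ⊕-exchange : ∀ a b c → a ⊕ (b ⊕ c) ≡ b ⊕ (a ⊕ c)
  ⊕-exchange a b c = trans (sym (assoc a b c)) (trans (cong (_⊕ c) (comm a b)) (assoc b a c))

  ∑-++ : ∀ {A : Set} (xs ys : List A) f → ∑ (xs ++ ys) f ≡ ∑ xs f ⊕ ∑ ys f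
  ∑-++ [] ys f = sym (identityˡ _)
  ∑-++ (a ∷ xs) ys f = trans (cong (f a ⊕_) (∑-++ xs ys f)) (sym (assoc _ _ _))

  ∑-cong-∈ : ∀ {A : Set} (xs : List A) {f g : A → C} →
    (∀ a → a ∈ xs → f a ≡ g a) → ∑ xs f ≡ ∑ xs g
  ∑-cong-∈ [] eq = refl
  ∑-cong-∈ (a ∷ xs) eq = cong₂ _⊕_ (eq a (here refl)) (∑-cong-∈ xs (λ b b∈ → eq b (there b∈)))

  ∑-cong : ∀ {A : Set} (xs : List A) {f g : A → C} → (∀ a → f a ≡ g a) → ∑ xs f ≡ ∑ xs g
  ∑-cong xs eq = ∑-cong-∈ xs (λ a _ → eq a)

  ∑-map : ∀ {A B : Set} (g : A → B) xs f → ∑ (map g xs) f ≡ ∑ xs (f ∘ g)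
  ∑-map g [] f = refl
  ∑-map g (a ∷ xs) f = cong (f (g a) ⊕_) (∑-map g xs f)

  ∑-concat : ∀ {A : Set} (xss : List (List A)) f → ∑ (concat xss) f ≡ ∑ xss (λ xs → ∑ xs f)
  ∑-concat [] f = refl
  ∑-concat (xs ∷ xss) f = trans (∑-++ xs (concat xss) f) (cong (∑ xs f ⊕_) (∑-concat xss f))

  ∑-concatMap : ∀ {A B : Set} (g : A → List B) xs f →
    ∑ (concatMap g xs) f ≡ ∑ xs (λ a → ∑ (g a) f)
  ∑-concatMap g xs f = trans (∑-concat (map g xs) f) (∑-map g xs _)

  ∑-filter : ∀ {A : Set} {P : A → Set} (P? : ∀ a → Dec (P a)) xs f →
    ∑ (filter P? xs) f ≡ ∑ xs (λ a → if does (P? a) then f a else ε)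
  ∑-filter P? [] f = refl
  ∑-filter P? (a ∷ xs) f with does (P? a)
  ... | true = cong (f a ⊕_) (∑-filter P? xs f)
  ... | false = trans (∑-filter P? xs f) (sym (identityˡ _))

  ∑-zero : ∀ {A : Set} (xs : List A) → ∑ xs (λ _ → ε) ≡ ε
  ∑-zero [] = refl
  ∑-zero (a ∷ xs) = trans (identityˡ _) (∑-zero xs)

  ∑-⊕ : ∀ {A : Set} (xs : List A) f g → ∑ xs (λ a → f a ⊕ g a) ≡ ∑ xs f ⊕ ∑ xs g
  ∑-⊕ [] f g = sym (identityˡ ε)
  ∑-⊕ (a ∷ xs) f g = begin
      (f a ⊕ g a) ⊕ ∑ xs (λ b → f b ⊕ g b)  ≡⟨ cong ((f a ⊕ g a) ⊕_) (∑-⊕ xs f g) ⟩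
      (f a ⊕ g a) ⊕ (∑ xs f ⊕ ∑ xs g)       ≡⟨ assoc _ _ _ ⟩
      f a ⊕ (g a ⊕ (∑ xs f ⊕ ∑ xs g))       ≡⟨ cong (f a ⊕_) (⊕-exchange _ _ _) ⟩
      f a ⊕ (∑ xs f ⊕ (g a ⊕ ∑ xs g))       ≡⟨ sym (assoc _ _ _) ⟩
      (f a ⊕ ∑ xs f) ⊕ (g a ⊕ ∑ xs g)       ∎

  ∑-swap : ∀ {A B : Set} (xs : List A) (ys : List B) (f : A → B → C) →
    ∑ xs (λ a → ∑ ys (f a)) ≡ ∑ ys (λ b → ∑ xs (λ a → f a b))
  ∑-swap [] ys f = sym (∑-zero ys)
  ∑-swap (a ∷ xs) ys f = trans (cong (∑ ys (f a) ⊕_) (∑-swap xs ys f))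
                               (sym (∑-⊕ ys (f a) (λ b → ∑ xs (λ a′ → f a′ b))))

  ∑-─ : ∀ {A : Set} {a : A} xs (p : a ∈ xs) f → ∑ xs f ≡ f a ⊕ ∑ (xs ─ p) f
  ∑-─ (b ∷ xs) (here refl) f = refl
  ∑-─ (b ∷ xs) (there p) f = trans (cong (f b ⊕_) (∑-─ xs p f)) (⊕-exchange _ _ _)

module Removal {A : Set} where

  ∈-─⁻ : ∀ {a e : A} xs (p : a ∈ xs) → e ∈ xs ─ p → e ∈ xs
  ∈-─⁻ (b ∷ xs) (here _) q = there q
  ∈-─⁻ (b ∷ xs) (there p) (here q) = here q
  ∈-─⁻ (b ∷ xs) (there p) (there q) = there (∈-─⁻ xs p q)

  ∈-─⁺ : ∀ {a e : A} xs (p : a ∈ xs) → e ∈ xs → e ≢ a → e ∈ xs ─ p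
  ∈-─⁺ (b ∷ xs) (here refl) (here refl) e≢a = ⊥-elim (e≢a refl)
  ∈-─⁺ (b ∷ xs) (here _) (there q) e≢a = q
  ∈-─⁺ (b ∷ xs) (there p) (here q) e≢a = here q
  ∈-─⁺ (b ∷ xs) (there p) (there q) e≢a = there (∈-─⁺ xs p q e≢a)

  unique-─ : ∀ {a : A} {xs} (p : a ∈ xs) → Unique xs → Unique (xs ─ p)
  unique-─ (here _) (_ ∷ u) = u
  unique-─ (there p) (b∉ ∷ u) = AllP.─⁺ p b∉ ∷ unique-─ p u

  ∉-─ : ∀ {a : A} {xs} (p : a ∈ xs) → Unique xs → a ∉ xs ─ p
  ∉-─ (here refl) (a∉ ∷ _) q = All.lookup a∉ q refl
  ∉-─ (there p) (b∉ ∷ _) (here refl) = All.lookup b∉ p refl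
  ∉-─ (there p) (_ ∷ u) (there q) = ∉-─ p u q

  length-─ : ∀ {a : A} xs (p : a ∈ xs) → length xs ≡ suc (length (xs ─ p))
  length-─ xs p = ListP.length-removeAt′ xs _

  unique-⊆-length : ∀ (xs ys : List A) → Unique xs → All (_∈ ys) xs → length xs ≤ length ys
  unique-⊆-length [] ys _ _ = N.z≤n
  unique-⊆-length (a ∷ xs) ys (a∉ ∷ u) (a∈ ∷ xs⊆) =
    subst (suc (length xs) ≤_) (sym (length-─ ys a∈))
      (N.s≤s (unique-⊆-length xs (ys ─ a∈) u
        (All.tabulate (λ {e} e∈ → ∈-─⁺ ys a∈ (All.lookup xs⊆ e∈) (λ e≡a → All.lookup a∉ e∈ (sym e≡a))))))

  ⊆-of-length : (_≟_ : DecidableEquality A) {M S : List A} → Unique M → All (_∈ S) M →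
    length S ≤ length M → ∀ {e} → e ∈ S → e ∈ M
  ⊆-of-length _≟_ {M} {S} uM M⊆S |S|≤|M| {e} e∈S with Data.List.Membership.DecPropositional._∈?_ _≟_ e M
  ... | yes e∈M = e∈M
  ... | no e∉M = ⊥-elim (NP.<⇒≱ (subst (N._≤ length M) (length-─ S e∈S) |S|≤|M|)
      (unique-⊆-length M (S ─ e∈S) uM
        (All.tabulate (λ {f} f∈M → ∈-─⁺ S e∈S (All.lookup M⊆S f∈M)
                                         (λ f≡e → e∉M (subst (_∈ M) f≡e f∈M))))))

open Removal

allPairs-∈ : ∀ {A : Set} {R : A → A → Set} → (∀ {a b} → R a b → R b a) →
  ∀ {xs a b} → AllPairs R xs → a ∈ xs → b ∈ xs → a ≢ b → R a b
allPairs-∈ R-sym (_ ∷ _) (here refl) (here refl) a≢b = ⊥-elim (a≢b refl)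
allPairs-∈ R-sym (ra ∷ _) (here refl) (there q) a≢b = All.lookup ra q
allPairs-∈ R-sym (rb ∷ _) (there p) (here refl) a≢b = R-sym (All.lookup rb p)
allPairs-∈ R-sym (_ ∷ rs) (there p) (there q) a≢b = allPairs-∈ R-sym rs p q a≢b

allPairs-tabulate : ∀ {A : Set} {R : A → A → Set} (xs : List A) → Unique xs →
  (∀ {a b} → a ∈ xs → b ∈ xs → a ≢ b → R a b) → AllPairs R xs
allPairs-tabulate [] _ _ = []
allPairs-tabulate (a ∷ xs) (a∉ ∷ u) R-∈ =
  All.tabulate (λ b∈ → R-∈ (here refl) (there b∈) (All.lookup a∉ b∈))
    ∷ allPairs-tabulate xs u (λ p q → R-∈ (there p) (there q))

module Restrict {C : Set} {_⊕_ : C → C → C} {ε : C}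
                (isCM : IsCommutativeMonoid _≡_ _⊕_ ε)
                {A : Set} (_≟_ : DecidableEquality A) where
  open IsCommutativeMonoid isCM using (identityˡ)
  open ListSum isCM
  open import Data.List.Membership.DecPropositional _≟_ using (_∈?_)

  ∑-restrict : ∀ (L X : List A) (h : A → C) → Unique L → Unique X → All (_∈ L) X →
    ∑ L (λ e → if does (e ∈? X) then h e else ε) ≡ ∑ X h
  ∑-restrict [] [] h _ _ _ = refl
  ∑-restrict [] (_ ∷ _) h _ _ (() ∷ _)
  ∑-restrict (a ∷ L) X h (a∉L ∷ uL) uX X⊆ with a ∈? X
  ... | yes a∈X = begin
      h a ⊕ ∑ L (λ e → if does (e ∈? X) then h e else ε)
        ≡⟨ cong (h a ⊕_) (∑-cong-∈ L (λ e e∈L → cong (λ b → if b then h e else ε)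
             (does-⇔ (mk⇔ (λ e∈X → ∈-─⁺ X a∈X e∈X (≢a e∈L)) (∈-─⁻ X a∈X))
                     (e ∈? X) (e ∈? X ─ a∈X)))) ⟩
      h a ⊕ ∑ L (λ e → if does (e ∈? X ─ a∈X) then h e else ε)
        ≡⟨ cong (h a ⊕_) (∑-restrict L (X ─ a∈X) h uL (unique-─ a∈X uX)
             (All.tabulate (λ e∈ → inTail (All.lookup X⊆ (∈-─⁻ X a∈X e∈)) (≢removed e∈)))) ⟩
      h a ⊕ ∑ (X ─ a∈X) h
        ≡⟨ sym (∑-─ X a∈X h) ⟩
      ∑ X h ∎
    where
    open ≡-Reasoning
    ≢a : ∀ {e} → e ∈ L → e ≢ a
    ≢a e∈L e≡a = All.lookup a∉L e∈L (sym e≡a)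
    ≢removed : ∀ {e} → e ∈ X ─ a∈X → e ≢ a
    ≢removed e∈ refl = ∉-─ a∈X uX e∈
    inTail : ∀ {e} → e ∈ a ∷ L → e ≢ a → e ∈ L
    inTail (here e≡a) e≢a = ⊥-elim (e≢a e≡a)
    inTail (there e∈L) _ = e∈L
  ... | no a∉X = trans (identityˡ _)
      (∑-restrict L X h uL uX (All.tabulate (λ e∈ → inTail e∈ (All.lookup X⊆ e∈))))
    where
    inTail : ∀ {e} → e ∈ X → e ∈ a ∷ L → e ∈ L
    inTail e∈X (here refl) = ⊥-elim (a∉X e∈X)
    inTail e∈X (there e∈L) = e∈L

module ∑ℕ = ListSum NP.+-0-isCommutativeMonoid
open ∑ℕ using () renaming (∑ to ∑ℕ)
module ∑ℚ = ListSum QP.+-0-isCommutativeMonoid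
open ∑ℚ using () renaming (∑ to ∑ℚ)

∑ℚ-* : ∀ {A : Set} (xs : List A) (c : ℚ) f → ∑ℚ xs (λ a → c *q f a) ≡ c *q ∑ℚ xs f
∑ℚ-* [] c f = sym (QP.*-zeroʳ c)
∑ℚ-* (a ∷ xs) c f = trans (cong (c *q f a +q_) (∑ℚ-* xs c f)) (sym (QP.*-distribˡ-+ c _ _))

ι : ℕ → ℚ
ι n = n ×ℚ 1ℚ

ι-+ : ∀ a b → ι (a N.+ b) ≡ ι a +q ι b
ι-+ = ×-homo-+ 1ℚ

ι-* : ∀ a b → ι (a * b) ≡ ι a *q ι b
ι-* = ×1-homo-*

∑ℚ-const : ∀ {A : Set} (xs : List A) c → ∑ℚ xs (λ _ → c) ≡ ι (length xs) *q c
∑ℚ-const [] c = sym (QP.*-zeroˡ c)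
∑ℚ-const (a ∷ xs) c = trans (cong (c +q_) (∑ℚ-const xs c))
  (solve 2 (λ l y → y :+ l :* y := (con 1ℚ :+ l) :* y) refl (ι (length xs)) c)
  where open +-*-Solver

recip-inverse : ∀ a → recip (suc a) *q ι (suc a) ≡ 1ℚ
recip-inverse a = QP.toℚᵘ-injective (ℚᵘP.≃-trans (QP.toℚᵘ-homo-* (recip (suc a)) (ι (suc a)))
    (ℚᵘP.≃-trans (ℚᵘP.*-cong (QP.toℚᵘ-fromℚᵘ (ℚᵘ.mkℚᵘ (+ 1) a)) (ιᵘ (suc a)))
      (ℚᵘ.*≡* (solve 1 (λ y → (con (+ 1) :* (con (+ 1) :+ y)) :* con (+ 1)
                            := con (+ 1) :* ((con (+ 1) :+ y) :* con (+ 1))) refl (+ a)))))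
  where
  open ℤSolver
  ιᵘ : ∀ s → Data.Rational.toℚᵘ (ι s) ℚᵘ.≃ ℚᵘ.mkℚᵘ (+ s) 0
  ιᵘ zero = ℚᵘP.≃-refl
  ιᵘ (suc s) = ℚᵘP.≃-trans (QP.toℚᵘ-homo-+ 1ℚ (ι s))
    (ℚᵘP.≃-trans (ℚᵘP.+-congʳ (Data.Rational.toℚᵘ 1ℚ) (ιᵘ s))
    (ℚᵘ.*≡* (solve 1 (λ y → (con (+ 1) :* con (+ 1) :+ y :* con (+ 1)) :* con (+ 1)
                          := (con (+ 1) :+ y) :* (con (+ 1) :* con (+ 1))) refl (+ s))))

δ : ∀ {n} → Mon n → Mon n → ℚ
δ m μ = if does (μ ≈ₘ? m) then 1ℚ else 0ℚ

termAt : ∀ {n} → Mon n → ℚ × Mon n → ℚ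
termAt m t = proj₁ t *q δ m (proj₂ t)

coeff-∑ : ∀ {n} (p : Poly n) m → coeff p m ≡ ∑ℚ p (termAt m)
coeff-∑ [] m = refl
coeff-∑ ((c , μ) ∷ p) m with does (μ ≈ₘ? m)
... | true = cong₂ _+q_ (sym (QP.*-identityʳ c)) (coeff-∑ p m)
... | false = trans (coeff-∑ p m)
    (sym (trans (cong (_+q ∑ℚ p (termAt m)) (QP.*-zeroʳ c)) (QP.+-identityˡ _)))

coeff-++ : ∀ {n} (p q : Poly n) m → coeff (p ++ q) m ≡ coeff p m +q coeff q m
coeff-++ p q m = trans (coeff-∑ (p ++ q) m)
  (trans (∑ℚ.∑-++ p q (termAt m)) (sym (cong₂ _+q_ (coeff-∑ p m) (coeff-∑ q m))))

coeff-* : ∀ {n} (q p : Poly n) m → coeff (q *ₚ p) m ≡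
  ∑ℚ q (λ s → ∑ℚ p (λ t → (proj₁ s *q proj₁ t) *q δ m (proj₂ s ·ₘ proj₂ t)))
coeff-* q p m = trans (coeff-∑ (q *ₚ p) m)
  (trans (∑ℚ.∑-concatMap _ q (termAt m)) (∑ℚ.∑-cong q (λ s → ∑ℚ.∑-map _ p (termAt m))))

coeff-sumₚ : ∀ {n} {A : Set} (f : A → Poly n) L m →
  coeff (sumₚ (map f L)) m ≡ ∑ℚ L (λ a → coeff (f a) m)
coeff-sumₚ f [] m = refl
coeff-sumₚ f (a ∷ L) m = trans (coeff-++ (f a) _ m) (cong (coeff (f a) m +q_) (coeff-sumₚ f L m))

coeff-scale : ∀ {n} c (p : Poly n) m → coeff (scale c p) m ≡ c *q coeff p m
coeff-scale c p m = trans (coeff-∑ (scale c p) m) (trans (∑ℚ.∑-map _ p (termAt m))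
  (trans (∑ℚ.∑-cong p (λ t → QP.*-assoc c (proj₁ t) _))
    (trans (∑ℚ-* p c (termAt m)) (cong (c *q_) (sym (coeff-∑ p m))))))

coeff-scale-* : ∀ {n} c (q p : Poly n) m → coeff (scale c q *ₚ p) m ≡ c *q coeff (q *ₚ p) m
coeff-scale-* c q p m = begin
    coeff (scale c q *ₚ p) m
      ≡⟨ trans (coeff-* (scale c q) p m) (∑ℚ.∑-map _ q _) ⟩
    ∑ℚ q (λ s → ∑ℚ p (λ t → ((c *q proj₁ s) *q proj₁ t) *q δ m (proj₂ s ·ₘ proj₂ t)))
      ≡⟨ ∑ℚ.∑-cong q (λ s → trans (∑ℚ.∑-cong p (λ t →
           trans (cong (_*q δ m (proj₂ s ·ₘ proj₂ t)) (QP.*-assoc c _ _)) (QP.*-assoc c _ _)))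
           (∑ℚ-* p c _)) ⟩
    ∑ℚ q (λ s → c *q ∑ℚ p (λ t → (proj₁ s *q proj₁ t) *q δ m (proj₂ s ·ₘ proj₂ t)))
      ≡⟨ trans (∑ℚ-* q c _) (cong (c *q_) (sym (coeff-* q p m))) ⟩
    c *q coeff (q *ₚ p) m ∎
  where open ≡-Reasoning

δ-cong : ∀ {n} (m μ ν : Mon n) → (∀ a b → μ a b ≡ ν a b) → δ m μ ≡ δ m ν
δ-cong m μ ν μ≗ν = cong (λ b → if b then 1ℚ else 0ℚ) (does-⇔
  (mk⇔ (All.map (λ {e} p → trans (sym (μ≗ν (proj₁ e) (proj₂ e))) p))
       (All.map (λ {e} p → trans (μ≗ν (proj₁ e) (proj₂ e)) p)))
  (μ ≈ₘ? m) (ν ≈ₘ? m))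

ind : Bool → ℚ
ind b = if b then 1ℚ else 0ℚ

coeff-if : ∀ {n} (b : Bool) (X : Poly n) m → coeff (if b then X else []) m ≡ ind b *q coeff X m
coeff-if true X m = sym (QP.*-identityˡ _)
coeff-if false X m = sym (QP.*-zeroˡ (coeff X m))

weighted : ∀ {n} → Poly n × Axiom n → Poly n
weighted qa = proj₁ qa *ₚ axiomPoly (proj₂ qa)

residue : ∀ {n} → List (Poly n × Axiom n) → Mon n → ℚ
residue qs m = ∑ℚ qs (λ qa → coeff (weighted qa) m)

derivation : ∀ {n d} {F G : Poly n} (qs : List (Poly n × Axiom n)) →
  (∀ m → coeff F m +q residue qs m ≡ coeff G m) → All (λ qa → DegLe (weighted qa) d) qs →
  DerivEq n d F G
derivation {F = F} qs balanced degrees =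
  qs , (λ m → trans (trans (coeff-++ F _ m) (cong (coeff F m +q_) (coeff-sumₚ weighted qs m)))
                    (balanced m)) , degrees

balance : ∀ {n d} {F G : Poly n} (D : DerivEq n d F G) m →
  coeff F m +q residue (proj₁ D) m ≡ coeff G m
balance {F = F} (qs , eq , _) m =
  trans (sym (trans (coeff-++ F _ m) (cong (coeff F m +q_) (coeff-sumₚ weighted qs m)))) (eq m)

derivRefl : ∀ {n d} {F G : Poly n} → (∀ m → coeff F m ≡ coeff G m) → DerivEq n d F G
derivRefl {F = F} {G} eq = derivation {F = F} {G} [] (λ m → trans (QP.+-identityʳ _) (eq m)) []

derivTrans : ∀ {n d} {F G H : Poly n} → DerivEq n d F G → DerivEq n d G H → DerivEq n d F H
derivTrans {F = F} {G} {H} D₁@(qs₁ , _ , deg₁) D₂@(qs₂ , _ , deg₂) =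
  derivation {F = F} {H} (qs₁ ++ qs₂) balanced (AllP.++⁺ deg₁ deg₂)
  where
  balanced : ∀ m → coeff F m +q residue (qs₁ ++ qs₂) m ≡ coeff H m
  balanced m = begin
      coeff F m +q residue (qs₁ ++ qs₂) m
        ≡⟨ cong (coeff F m +q_) (∑ℚ.∑-++ qs₁ qs₂ _) ⟩
      coeff F m +q (residue qs₁ m +q residue qs₂ m)
        ≡⟨ sym (QP.+-assoc (coeff F m) (residue qs₁ m) (residue qs₂ m)) ⟩
      (coeff F m +q residue qs₁ m) +q residue qs₂ m
        ≡⟨ cong (_+q residue qs₂ m) (balance {F = F} {G} D₁ m) ⟩
      coeff G m +q residue qs₂ m
        ≡⟨ balance {F = G} {H} D₂ m ⟩
      coeff H m ∎
    where open ≡-Reasoning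

derivAdd : ∀ {n d} {F G F′ G′ : Poly n} →
  DerivEq n d F G → DerivEq n d F′ G′ → DerivEq n d (F ++ F′) (G ++ G′)
derivAdd {F = F} {G} {F′} {G′} D₁@(qs₁ , _ , deg₁) D₂@(qs₂ , _ , deg₂) =
  derivation {F = F ++ F′} {G ++ G′} (qs₁ ++ qs₂) balanced (AllP.++⁺ deg₁ deg₂)
  where
  balanced : ∀ m → coeff (F ++ F′) m +q residue (qs₁ ++ qs₂) m ≡ coeff (G ++ G′) m
  balanced m = begin
      coeff (F ++ F′) m +q residue (qs₁ ++ qs₂) m
        ≡⟨ cong₂ _+q_ (coeff-++ F F′ m) (∑ℚ.∑-++ qs₁ qs₂ _) ⟩
      (coeff F m +q coeff F′ m) +q (residue qs₁ m +q residue qs₂ m)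
        ≡⟨ solve 4 (λ a b c d → (a :+ b) :+ (c :+ d) := (a :+ c) :+ (b :+ d)) refl
             (coeff F m) (coeff F′ m) (residue qs₁ m) (residue qs₂ m) ⟩
      (coeff F m +q residue qs₁ m) +q (coeff F′ m +q residue qs₂ m)
        ≡⟨ cong₂ _+q_ (balance {F = F} {G} D₁ m) (balance {F = F′} {G′} D₂ m) ⟩
      coeff G m +q coeff G′ m
        ≡⟨ sym (coeff-++ G G′ m) ⟩
      coeff (G ++ G′) m ∎
    where
    open ≡-Reasoning
    open +-*-Solver

derivSum : ∀ {n d} {A : Set} (L : List A) (F G : A → Poly n) →
  (∀ a → DerivEq n d (F a) (G a)) → DerivEq n d (sumₚ (map F L)) (sumₚ (map G L))
derivSum [] F G D = derivRefl {F = []} {G = []} (λ m → refl)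
derivSum (a ∷ L) F G D =
  derivAdd {F = F a} {G a} {sumₚ (map F L)} {sumₚ (map G L)} (D a) (derivSum L F G D)

derivScale : ∀ {n d} c {F G : Poly n} → DerivEq n d F G → DerivEq n d (scale c F) (scale c G)
derivScale {n} {d} c {F} {G} D@(qs , _ , degrees) =
  derivation {F = scale c F} {scale c G} (map scaled qs) balanced (AllP.map⁺ (All.map (λ {qa} → scaledDeg {qa}) degrees))
  where
  scaled : Poly n × Axiom n → Poly n × Axiom n
  scaled (q , a) = scale c q , a
  scaledCoeff : ∀ qa m → coeff (weighted (scaled qa)) m ≡ c *q coeff (weighted qa) m
  scaledCoeff (q , a) = coeff-scale-* c q (axiomPoly a)
  scaledDeg : ∀ {qa} → DegLe (weighted qa) d → DegLe (weighted (scaled qa)) d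
  scaledDeg {qa} bound m ≢0 =
    bound m (λ z → ≢0 (trans (scaledCoeff qa m) (trans (cong (c *q_) z) (QP.*-zeroʳ c))))
  balanced : ∀ m → coeff (scale c F) m +q residue (map scaled qs) m ≡ coeff (scale c G) m
  balanced m = begin
      coeff (scale c F) m +q residue (map scaled qs) m
        ≡⟨ cong₂ _+q_ (coeff-scale c F m)
             (trans (∑ℚ.∑-map scaled qs _) (trans (∑ℚ.∑-cong qs (λ qa → scaledCoeff qa m)) (∑ℚ-* qs c _))) ⟩
      c *q coeff F m +q c *q residue qs m
        ≡⟨ sym (QP.*-distribˡ-+ c _ _) ⟩
      c *q (coeff F m +q residue qs m)
        ≡⟨ cong (c *q_) (balance {F = F} {G} D m) ⟩
      c *q coeff G m
        ≡⟨ sym (coeff-scale c G m) ⟩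
      coeff (scale c G) m ∎
    where open ≡-Reasoning

derivIf : ∀ {n d} {P : Set} (p : Dec P) (X Y : Poly n) → (P → DerivEq n d X Y) →
  DerivEq n d (if does p then X else []) (if does p then Y else [])
derivIf (yes p) X Y D = D p
derivIf (no _) X Y D = derivRefl {F = []} {G = []} (λ m → refl)

edge-lt : ∀ {n} {u v : Fin n} → u < v → edge u v ≡ (u , v)
edge-lt {u = u} {v} u<v rewrite dec-true (u <? v) u<v = refl

edge-gt : ∀ {n} {u v : Fin n} → v < u → edge u v ≡ (v , u)
edge-gt {u = u} {v} v<u rewrite dec-false (u <? v) (FinP.<-asym v<u) = refl

edge-canonical : ∀ {n} (e : Edge n) → IsEdge e → edge (proj₁ e) (proj₂ e) ≡ e
edge-canonical (u , v) u<v = edge-lt u<v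

VertexDisjoint-sym : ∀ {n} {e f : Edge n} → VertexDisjoint e f → VertexDisjoint f e
VertexDisjoint-sym (a≢c , a≢d , b≢c , b≢d) =
  (λ z → a≢c (sym z)) , (λ z → b≢c (sym z)) , (λ z → a≢d (sym z)) , (λ z → b≢d (sym z))

VertexDisjoint-irrefl : ∀ {n} (e : Edge n) → ¬ VertexDisjoint e e
VertexDisjoint-irrefl e (a≢a , _) = a≢a refl

matching-unique : ∀ {n} {M : List (Edge n)} → IsMatching M → Unique M
matching-unique (_ , disjoint) = AllPairs.map
  (λ {e} {f} e∥f e≡f → VertexDisjoint-irrefl f (subst (λ g → VertexDisjoint g f) e≡f e∥f)) disjoint

matching-disjoint : ∀ {n} {M : List (Edge n)} → IsMatching M →
  ∀ {e f} → e ∈ M → f ∈ M → e ≢ f → VertexDisjoint e f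
matching-disjoint (_ , disjoint) = allPairs-∈ VertexDisjoint-sym disjoint

isEdge? : ∀ {n} (e : Edge n) → Dec (IsEdge e)
isEdge? e = proj₁ e <? proj₂ e

private
  allPairs-≡ : ∀ n → concatMap (λ u → map (λ v → (u , v)) (allFin n)) (allFin n)
                     ≡ Data.List.cartesianProduct (allFin n) (allFin n)
  allPairs-≡ n = go (allFin n)
    where
    go : ∀ us → concatMap (λ u → map (λ v → (u , v)) (allFin n)) us
                ≡ Data.List.cartesianProduct us (allFin n)
    go [] = refl
    go (u ∷ us) = cong (map (λ v → (u , v)) (allFin n) ++_) (go us)

allEdges-unique : ∀ n → Unique (allEdges n)
allEdges-unique n = UniqueP.filter⁺ isEdge?
  (subst Unique (sym (allPairs-≡ n)) (UniqueP.cartesianProduct⁺ (UniqueP.allFin⁺ n) (UniqueP.allFin⁺ n)))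

∈-allEdges : ∀ {n} (e : Edge n) → IsEdge e → e ∈ allEdges n
∈-allEdges {n} (u , v) u<v = ∈P.∈-filter⁺ isEdge?
  (subst ((u , v) ∈_) (sym (allPairs-≡ n)) (∈P.∈-cartesianProduct⁺ (∈P.∈-allFin u) (∈P.∈-allFin v))) u<v

allEdges-isEdge : ∀ {n} {e : Edge n} → e ∈ allEdges n → IsEdge e
allEdges-isEdge {n} e∈ =
  proj₂ (∈P.∈-filter⁻ isEdge? {xs = concatMap (λ u → map (λ v → (u , v)) (allFin n)) (allFin n)} e∈)

matching-⊆-allEdges : ∀ {n} {M : List (Edge n)} → IsMatching M → All (_∈ allEdges n) M
matching-⊆-allEdges (edges , _) = All.map (λ {e} → ∈-allEdges e) edges

∑ℚ-allEdges : ∀ n (g : Edge n → ℚ) → ∑ℚ (allEdges n) g ≡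
  ∑ℚ (allFin n) (λ u → ∑ℚ (allFin n) (λ v → if does (u <? v) then g (u , v) else 0ℚ))
∑ℚ-allEdges n g = trans (∑ℚ.∑-filter isEdge? (concatMap (λ u → map (λ v → (u , v)) (allFin n)) (allFin n)) g)
  (trans (∑ℚ.∑-concatMap _ (allFin n) _) (∑ℚ.∑-cong (allFin n) (λ u → ∑ℚ.∑-map _ (allFin n) _)))

exponent : ∀ {n} → Mon n → Edge n → ℕ
exponent μ e = μ (proj₁ e) (proj₂ e)

monOf : ∀ {n} → List (Edge n) → Mon n
monOf = foldr (λ e μ → varMon (edge (proj₁ e) (proj₂ e)) ·ₘ μ) unitMon

xM-monomial : ∀ {n} (L : List (Edge n)) → xM L ≡ (1ℚ , monOf L) ∷ []
xM-monomial [] = refl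
xM-monomial (e ∷ L) rewrite xM-monomial L = refl

coeff-xM : ∀ {n} (L : List (Edge n)) m → coeff (xM L) m ≡ δ m (monOf L)
coeff-xM L m rewrite xM-monomial L with does (monOf L ≈ₘ? m)
... | true = refl
... | false = refl

monOf-∑ : ∀ {n} (L : List (Edge n)) a b → monOf L a b ≡ ∑ℕ L (λ e → varMon (edge (proj₁ e) (proj₂ e)) a b)
monOf-∑ [] a b = refl
monOf-∑ (e ∷ L) a b = cong (varMon (edge (proj₁ e) (proj₂ e)) a b N.+_) (monOf-∑ L a b)

monOf-─ : ∀ {n} {e : Edge n} (M : List (Edge n)) (e∈M : e ∈ M) → IsEdge e →
  ∀ a b → monOf M a b ≡ varMon e a b N.+ monOf (M ─ e∈M) a b
monOf-─ {e = e} M e∈M e-edge a b = begin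
    monOf M a b
      ≡⟨ monOf-∑ M a b ⟩
    ∑ℕ M (λ f → varMon (edge (proj₁ f) (proj₂ f)) a b)
      ≡⟨ ∑ℕ.∑-─ M e∈M _ ⟩
    varMon (edge (proj₁ e) (proj₂ e)) a b N.+ ∑ℕ (M ─ e∈M) (λ f → varMon (edge (proj₁ f) (proj₂ f)) a b)
      ≡⟨ cong₂ N._+_ (cong (λ f → varMon f a b) (edge-canonical e e-edge)) (sym (monOf-∑ (M ─ e∈M) a b)) ⟩
    varMon e a b N.+ monOf (M ─ e∈M) a b ∎
  where open ≡-Reasoning

deg-∑ : ∀ {n} (μ : Mon n) → deg μ ≡ ∑ℕ (allEdges n) (exponent μ)
deg-∑ {n} μ = sumMap _ (allEdges n)
  where
  sumMap : ∀ {A : Set} (f : A → ℕ) L → Data.Nat.ListAction.sum (map f L) ≡ ∑ℕ L f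
  sumMap f [] = refl
  sumMap f (a ∷ L) = cong (f a N.+_) (sumMap f L)

deg-≈ : ∀ {n} {μ ν : Mon n} → μ ≈ₘ ν → deg μ ≡ deg ν
deg-≈ {n} {μ} {ν} μ≈ν =
  trans (deg-∑ μ) (trans (∑ℕ.∑-cong-∈ (allEdges n) (λ e e∈ → All.lookup μ≈ν e∈)) (sym (deg-∑ ν)))

deg-· : ∀ {n} (μ ν : Mon n) → deg (μ ·ₘ ν) ≡ deg μ N.+ deg ν
deg-· {n} μ ν = trans (deg-∑ (μ ·ₘ ν))
  (trans (∑ℕ.∑-⊕ (allEdges n) _ _) (sym (cong₂ N._+_ (deg-∑ μ) (deg-∑ ν))))

deg-unit : ∀ {n} → deg (unitMon {n}) ≡ 0
deg-unit {n} = trans (deg-∑ (unitMon {n})) (∑ℕ.∑-zero (allEdges n))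

varMon-cases : ∀ {n} (e : Edge n) a b → (varMon e a b ≡ 0) ⊎ (varMon e a b ≡ 1 × e ≡ (a , b))
varMon-cases (u , v) a b with u FinP.≟ a | v FinP.≟ b
... | yes refl | yes refl = inj₂ (refl , refl)
... | yes _ | no _ = inj₁ refl
... | no _ | _ = inj₁ refl

varMon-count : ∀ {n} (e : Edge n) L → Unique L → ∑ℕ L (exponent (varMon e)) ≤ 1
varMon-count e [] _ = N.z≤n
varMon-count e (f ∷ L) (f∉ ∷ u) with varMon-cases e (proj₁ f) (proj₂ f)
... | inj₁ exp≡0 = subst (_≤ 1) (sym (cong (N._+ ∑ℕ L (exponent (varMon e))) exp≡0)) (varMon-count e L u)
... | inj₂ (one , refl) = subst (_≤ 1) (sym (cong₂ N._+_ one (absent L f∉))) NP.≤-refl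
  where
  absent : ∀ L → All (e ≢_) L → ∑ℕ L (exponent (varMon e)) ≡ 0
  absent [] _ = refl
  absent (g ∷ L) (e≢g ∷ e∉) with varMon-cases e (proj₁ g) (proj₂ g)
  ... | inj₁ exp≡0 = trans (cong (N._+ ∑ℕ L (exponent (varMon e))) exp≡0) (absent L e∉)
  ... | inj₂ (_ , e≡g) = ⊥-elim (e≢g e≡g)

deg-varMon : ∀ {n} (e : Edge n) → deg (varMon e) ≤ 1
deg-varMon {n} e = subst (_≤ 1) (sym (deg-∑ (varMon e))) (varMon-count e (allEdges n) (allEdges-unique n))

deg-monOf : ∀ {n} (L : List (Edge n)) → deg (monOf L) ≤ length L
deg-monOf {n} [] = NP.≤-reflexive (deg-unit {n})
deg-monOf (e ∷ L) = subst (_≤ suc (length L)) (sym (deg-· _ (monOf L)))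
  (NP.+-mono-≤ (deg-varMon (edge (proj₁ e) (proj₂ e))) (deg-monOf L))

deg-·varMon : ∀ {n} (μ : Mon n) e → deg (μ ·ₘ varMon e) ≤ deg μ N.+ 1
deg-·varMon μ e = NP.≤-trans (NP.≤-reflexive (deg-· μ (varMon e))) (NP.+-monoʳ-≤ (deg μ) (deg-varMon e))

deg-·varMon² : ∀ {n} (μ : Mon n) e f → deg (μ ·ₘ (varMon e ·ₘ varMon f)) ≤ deg μ N.+ 2
deg-·varMon² μ e f = NP.≤-trans (NP.≤-reflexive (trans (deg-· μ _) (cong (deg μ N.+_) (deg-· (varMon e) (varMon f)))))
  (NP.+-monoʳ-≤ (deg μ) (NP.+-mono-≤ (deg-varMon e) (deg-varMon f)))

degLe-monomial-* : ∀ {n} c (μ : Mon n) (p : Poly n) k →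
  All (λ t → deg (μ ·ₘ proj₂ t) ≤ k) p → DegLe (((c , μ) ∷ []) *ₚ p) k
degLe-monomial-* {n} c μ p k bounded m ≢0 with deg m N.≤? k
... | yes ≤k = ≤k
... | no >k = ⊥-elim (≢0 (trans (coeff-* ((c , μ) ∷ []) p m)
      (trans (cong (_+q 0ℚ) (trans (∑ℚ.∑-cong-∈ p (λ t t∈ → trans (cong ((c *q proj₁ t) *q_) (δ-0 t t∈))
                                                          (QP.*-zeroʳ (c *q proj₁ t))))
                                   (∑ℚ.∑-zero p)))
             (QP.+-identityʳ 0ℚ))))
  where
  δ-0 : ∀ t → t ∈ p → δ m (μ ·ₘ proj₂ t) ≡ 0ℚ
  δ-0 t t∈ with (μ ·ₘ proj₂ t) ≈ₘ? m
  ... | yes ≈m = ⊥-elim (>k (subst (_≤ k) (deg-≈ ≈m) (All.lookup bounded t∈)))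
  ... | no _ = refl

coeff-monomial-* : ∀ {n} c (μ : Mon n) (p : Poly n) m →
  coeff (((c , μ) ∷ []) *ₚ p) m ≡ c *q ∑ℚ p (λ t → proj₁ t *q δ m (μ ·ₘ proj₂ t))
coeff-monomial-* c μ p m = trans (coeff-* ((c , μ) ∷ []) p m) (trans (QP.+-identityʳ _)
  (trans (∑ℚ.∑-cong p (λ t → QP.*-assoc c (proj₁ t) (δ m (μ ·ₘ proj₂ t)))) (∑ℚ-* p c _)))

coeff-bool : ∀ {n} c (μ : Mon n) u v (u≢v : u ≢ v) m →
  coeff (((c , μ) ∷ []) *ₚ axiomPoly (bool u v u≢v)) m ≡
    c *q δ m (μ ·ₘ (varMon (edge u v) ·ₘ varMon (edge u v))) +q (-q c) *q δ m (μ ·ₘ varMon (edge u v))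
coeff-bool c μ u v u≢v m = trans (coeff-* ((c , μ) ∷ []) (axiomPoly (bool u v u≢v)) m)
  (solve 3 (λ c A B → ((c :* (con 1ℚ :* con 1ℚ)) :* A :+ ((c :* (con (-q 1ℚ) :* con 1ℚ)) :* B :+ con 0ℚ)) :+ con 0ℚ
                       := c :* A :+ (:- c) :* B) refl c
     (δ m (μ ·ₘ (varMon (edge u v) ·ₘ varMon (edge u v)))) (δ m (μ ·ₘ varMon (edge u v))))
  where open +-*-Solver

bool-degrees : ∀ {n} (μ : Mon n) u v (u≢v : u ≢ v) k → deg μ N.+ 2 ≤ k →
  All (λ t → deg (μ ·ₘ proj₂ t) ≤ k) (axiomPoly (bool u v u≢v))
bool-degrees μ u v u≢v k bound = NP.≤-trans (deg-·varMon² μ (edge u v) (edge u v)) bound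
  ∷ NP.≤-trans (deg-·varMon μ (edge u v)) (NP.≤-trans (NP.+-monoʳ-≤ (deg μ) (N.s≤s N.z≤n)) bound) ∷ []

-- Two distinct canonical edges e = uv and f = uw meeting in the vertex u; then the
-- disjointness axiom x_{uw} x_{uv} is the product x_f x_e.
record Wedge {n} (e f : Edge n) : Set where
  field
    u v w : Fin n
    u≢w : u ≢ w
    u≢v : u ≢ v
    w≢v : w ≢ v
    e≡uv : edge u v ≡ e
    f≡uw : edge u w ≡ f

  axiom : Axiom n
  axiom = disj u w v u≢w u≢v w≢v

wedge : ∀ {n} (e f : Edge n) → IsEdge e → IsEdge f → e ≢ f → ¬ VertexDisjoint e f → Wedge e f
wedge (a , b) (c , d) a<b c<d e≢f meet with a FinP.≟ c
... | yes refl = record { u = a ; v = b ; w = d ; u≢w = FinP.<⇒≢ c<d ; u≢v = FinP.<⇒≢ a<b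
                        ; w≢v = λ d≡b → e≢f (cong (a ,_) (sym d≡b)) ; e≡uv = edge-lt a<b ; f≡uw = edge-lt c<d }
... | no a≢c with a FinP.≟ d
...   | yes refl = record { u = a ; v = b ; w = c ; u≢w = a≢c ; u≢v = FinP.<⇒≢ a<b
                          ; w≢v = λ c≡b → FinP.<-asym a<b (subst (_< a) c≡b c<d)
                          ; e≡uv = edge-lt a<b ; f≡uw = edge-gt c<d }
...   | no a≢d with b FinP.≟ c
...     | yes refl = record { u = b ; v = a ; w = d ; u≢w = FinP.<⇒≢ c<d ; u≢v = λ b≡a → FinP.<⇒≢ a<b (sym b≡a)
                            ; w≢v = λ d≡a → a≢d (sym d≡a) ; e≡uv = edge-gt a<b ; f≡uw = edge-lt c<d }
...     | no b≢c with b FinP.≟ d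
...       | yes refl = record { u = b ; v = a ; w = c ; u≢w = b≢c ; u≢v = λ b≡a → FinP.<⇒≢ a<b (sym b≡a)
                              ; w≢v = λ c≡a → a≢c (sym c≡a) ; e≡uv = edge-gt a<b ; f≡uw = edge-gt c<d }
...       | no b≢d = ⊥-elim (meet (a≢c , a≢d , b≢c , b≢d))

coeff-wedge : ∀ {n} {e f : Edge n} (W : Wedge e f) c (μ : Mon n) m →
  coeff (((c , μ) ∷ []) *ₚ axiomPoly (Wedge.axiom W)) m ≡ c *q δ m (μ ·ₘ (varMon f ·ₘ varMon e))
coeff-wedge W c μ m = trans (coeff-monomial-* c μ (axiomPoly (Wedge.axiom W)) m) (cong (c *q_)
  (trans (QP.+-identityʳ _) (trans (QP.*-identityˡ _)
    (cong₂ (λ f e → δ m (μ ·ₘ (varMon f ·ₘ varMon e))) (Wedge.f≡uw W) (Wedge.e≡uv W)))))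

wedge-degrees : ∀ {n} {e f : Edge n} (W : Wedge e f) (μ : Mon n) k → deg μ N.+ 2 ≤ k →
  All (λ t → deg (μ ·ₘ proj₂ t) ≤ k) (axiomPoly (Wedge.axiom W))
wedge-degrees W μ k bound =
  NP.≤-trans (deg-·varMon² μ (edge (Wedge.u W) (Wedge.w W)) (edge (Wedge.u W) (Wedge.v W))) bound ∷ []

∑-ordered-pairs : ∀ n (g : Edge n → ℚ) →
  ∑ℚ (allFin n) (λ v → ∑ℚ (allFin n) (λ u → if does (¬? (u FinP.≟ v)) then g (edge u v) else 0ℚ)) ≡
    ∑ℚ (allEdges n) g +q ∑ℚ (allEdges n) g
∑-ordered-pairs n g = begin
    ∑ℚ V (λ v → ∑ℚ V (λ u → if does (¬? (u FinP.≟ v)) then g (edge u v) else 0ℚ))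
      ≡⟨ ∑ℚ.∑-cong V (λ v → trans (∑ℚ.∑-cong V (λ u → split u v)) (∑ℚ.∑-⊕ V _ _)) ⟩
    ∑ℚ V (λ v → ∑ℚ V (λ u → ordered u v) +q ∑ℚ V (λ u → ordered v u))
      ≡⟨ ∑ℚ.∑-⊕ V _ _ ⟩
    ∑ℚ V (λ v → ∑ℚ V (λ u → ordered u v)) +q ∑ℚ V (λ v → ∑ℚ V (λ u → ordered v u))
      ≡⟨ cong₂ _+q_ (trans (∑ℚ.∑-swap V V (λ v u → ordered u v)) (sym (∑ℚ-allEdges n g)))
                    (sym (∑ℚ-allEdges n g)) ⟩
    ∑ℚ (allEdges n) g +q ∑ℚ (allEdges n) g ∎
  where
  open ≡-Reasoning
  V = allFin n
  ordered : Fin n → Fin n → ℚ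
  ordered u v = if does (u <? v) then g (u , v) else 0ℚ
  split : ∀ u v → (if does (¬? (u FinP.≟ v)) then g (edge u v) else 0ℚ) ≡ ordered u v +q ordered v u
  split u v with FinP.<-cmp u v
  ... | tri< u<v _ _ rewrite dec-true (¬? (u FinP.≟ v)) (FinP.<⇒≢ u<v) | dec-true (u <? v) u<v
                           | dec-false (v <? u) (FinP.<-asym u<v) = sym (QP.+-identityʳ _)
  ... | tri≈ _ refl _ rewrite dec-false (¬? (u FinP.≟ u)) (λ u≢u → u≢u refl)
                            | dec-false (u <? u) (FinP.<-irrefl refl) = refl
  ... | tri> _ _ v<u rewrite dec-true (¬? (u FinP.≟ v)) (λ u≡v → FinP.<⇒≢ v<u (sym u≡v))
                           | dec-false (u <? v) (FinP.<-asym v<u) | dec-true (v <? u) v<u = sym (QP.+-identityˡ _)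

coeff-cover : ∀ {n} c (μ : Mon n) v m →
  coeff (((c , μ) ∷ []) *ₚ axiomPoly (cover v)) m ≡
    c *q (∑ℚ (allFin n) (λ u → if does (¬? (u FinP.≟ v)) then δ m (μ ·ₘ varMon (edge u v)) else 0ℚ)
          +q (-q 1ℚ) *q δ m (μ ·ₘ unitMon))
coeff-cover {n} c μ v m = trans (coeff-monomial-* c μ (axiomPoly (cover v)) m) (cong (c *q_)
  (trans (∑ℚ.∑-++ (sumₚ (map (λ u → x u v) others)) _ termAt′)
    (cong₂ _+q_
      (trans (∑ℚ.∑-concat (map (λ u → x u v) others) termAt′)
        (trans (∑ℚ.∑-map (λ u → x u v) others _)
          (trans (∑ℚ.∑-filter (λ u → ¬? (u FinP.≟ v)) (allFin n) _)
            (∑ℚ.∑-cong (allFin n) (λ u → cong (λ y → if does (¬? (u FinP.≟ v)) then y else 0ℚ)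
              (trans (QP.+-identityʳ _) (QP.*-identityˡ _)))))))
      (QP.+-identityʳ _))))
  where
  others = filter (λ u → ¬? (u FinP.≟ v)) (allFin n)
  termAt′ = λ (t : ℚ × Mon n) → proj₁ t *q δ m (μ ·ₘ proj₂ t)

coeff-covers : ∀ {n} c (μ : Mon n) m →
  ∑ℚ (allFin n) (λ v → coeff (((c , μ) ∷ []) *ₚ axiomPoly (cover v)) m) ≡
    c *q ((∑ℚ (allEdges n) (λ e → δ m (μ ·ₘ varMon e)) +q ∑ℚ (allEdges n) (λ e → δ m (μ ·ₘ varMon e)))
          +q ι n *q ((-q 1ℚ) *q δ m μ))
coeff-covers {n} c μ m = begin
    ∑ℚ V (λ v → coeff (((c , μ) ∷ []) *ₚ axiomPoly (cover v)) m)
      ≡⟨ trans (∑ℚ.∑-cong V (λ v → coeff-cover c μ v m)) (∑ℚ-* V c _) ⟩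
    c *q ∑ℚ V (λ v → ∑ℚ V (λ u → if does (¬? (u FinP.≟ v)) then g (edge u v) else 0ℚ)
                     +q (-q 1ℚ) *q δ m (μ ·ₘ unitMon))
      ≡⟨ cong (c *q_) (∑ℚ.∑-⊕ V _ _) ⟩
    c *q (∑ℚ V (λ v → ∑ℚ V (λ u → if does (¬? (u FinP.≟ v)) then g (edge u v) else 0ℚ))
          +q ∑ℚ V (λ v → (-q 1ℚ) *q δ m (μ ·ₘ unitMon)))
      ≡⟨ cong (c *q_) (cong₂ _+q_ (∑-ordered-pairs n g) (∑ℚ-const V _)) ⟩
    c *q ((G +q G) +q ι (length V) *q ((-q 1ℚ) *q δ m (μ ·ₘ unitMon)))
      ≡⟨ cong₂ (λ l y → c *q ((G +q G) +q ι l *q ((-q 1ℚ) *q y)))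
           (ListP.length-tabulate {n = n} (λ i → i)) (δ-cong m _ _ (λ a b → NP.+-identityʳ (μ a b))) ⟩
    c *q ((G +q G) +q ι n *q ((-q 1ℚ) *q δ m μ)) ∎
  where
  open ≡-Reasoning
  V = allFin n
  g : Edge n → ℚ
  g e = δ m (μ ·ₘ varMon e)
  G = ∑ℚ (allEdges n) g

cover-degrees : ∀ {n} (μ : Mon n) v k → deg μ N.+ 1 ≤ k →
  All (λ t → deg (μ ·ₘ proj₂ t) ≤ k) (axiomPoly (cover v))
cover-degrees {n} μ v k bound = AllP.++⁺
  (AllP.concat⁺ (AllP.map⁺ {f = λ u → x u v}
    (All.universal (λ u → NP.≤-trans (deg-·varMon μ (edge u v)) bound ∷ [])
                   (filter (λ u → ¬? (u FinP.≟ v)) (allFin n)))))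
  (NP.≤-trans (NP.≤-reflexive (trans (deg-· μ unitMon) (trans (cong (deg μ N.+_) (deg-unit {n})) (NP.+-identityʳ _))))
     (NP.≤-trans (NP.m≤m+n (deg μ) 1) bound) ∷ [])

-- The one-edge step:  x_M ≡_(P_n,k) (h−d)⁻¹ · Σ_{e disjoint from M} x_{M+e}

_∈ₑ?_ : ∀ {n} (e : Edge n) (L : List (Edge n)) → Dec (e ∈ L)
_∈ₑ?_ {n} = Data.List.Membership.DecPropositional._∈?_ (_≟ₑ_ {n})

extends? : ∀ {n} (M : List (Edge n)) (e : Edge n) → Dec (IsEdge e × All (VertexDisjoint e) M)
extends? M e = isEdge? e ×-dec All.all? (VertexDisjoint? e) M

extendBy : ∀ {n} → List (Edge n) → Edge n → Poly n
extendBy M e = if does (extends? M e) then xM (e ∷ M) else []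

½ : ℚ
½ = + 1 Data.Rational./ 2

-- the scalar identity behind the step: with n = 2h, h = a + d and r·a = 1,
-- x_M + (r/2)(2G − n x_M) + (r S + r d x_M − r G) = r S
step-algebra : ∀ r a d δM G S → r *q a ≡ 1ℚ →
  δM +q ((r *q ½) *q ((G +q G) +q ((a +q d) +q (a +q d)) *q ((-q 1ℚ) *q δM))
         +q ((r *q S +q r *q (d *q δM)) +q (-q r) *q G)) ≡ r *q S
step-algebra r a d δM G S ra≡1 = begin
    δM +q ((r *q ½) *q ((G +q G) +q ((a +q d) +q (a +q d)) *q ((-q 1ℚ) *q δM))
           +q ((r *q S +q r *q (d *q δM)) +q (-q r) *q G))
      ≡⟨ solve 7 (λ R H G A D Δ S →
           Δ :+ ((R :* H) :* ((G :+ G) :+ ((A :+ D) :+ (A :+ D)) :* ((:- con 1ℚ) :* Δ))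
                 :+ ((R :* S :+ R :* (D :* Δ)) :+ (:- R) :* G))
           := R :* S :+ (Δ :* (con 1ℚ :- (R :* A) :* (H :+ H)) :+ (R :* G :- R :* (D :* Δ)) :* ((H :+ H) :- con 1ℚ)))
           refl r ½ G a d δM S ⟩
    r *q S +q (δM *q (1ℚ -q (r *q a) *q (½ +q ½)) +q (r *q G -q r *q (d *q δM)) *q ((½ +q ½) -q 1ℚ))
      ≡⟨ cong (λ ra → r *q S +q (δM *q (1ℚ -q ra *q 1ℚ) +q (r *q G -q r *q (d *q δM)) *q (1ℚ -q 1ℚ))) ra≡1 ⟩
    r *q S +q (δM *q (1ℚ -q 1ℚ *q 1ℚ) +q (r *q G -q r *q (d *q δM)) *q (1ℚ -q 1ℚ))
      ≡⟨ solve 4 (λ R S Δ Y → R :* S :+ (Δ :* (con 1ℚ :- con 1ℚ :* con 1ℚ) :+ Y :* (con 1ℚ :- con 1ℚ)) := R :* S)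
           refl r S δM (r *q G -q r *q (d *q δM)) ⟩
    r *q S ∎
  where
  open ≡-Reasoning
  open +-*-Solver

module OneEdgeStep {n : ℕ} (M : List (Edge n)) (mat : IsMatching M)
                   (d k : ℕ) (|M|≡d : length M ≡ d) (d<k : suc d ≤ k) (r : ℚ) where

  μM : Mon n
  μM = monOf M

  g : Mon n → Edge n → ℚ
  g m e = δ m (μM ·ₘ varMon e)

  isEdge-∈M : ∀ {f} → f ∈ M → IsEdge f
  isEdge-∈M = All.lookup (proj₁ mat)

  removed-· : ∀ {f} (f∈M : f ∈ M) a b → monOf (M ─ f∈M) a b N.+ varMon f a b ≡ μM a b
  removed-· {f} f∈M a b = trans (NP.+-comm (monOf (M ─ f∈M) a b) (varMon f a b)) (sym (monOf-─ M f∈M (isEdge-∈M f∈M) a b))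

  removed-bound : ∀ {f} (f∈M : f ∈ M) → deg (monOf (M ─ f∈M)) N.+ 2 ≤ k
  removed-bound f∈M = NP.≤-trans (NP.+-monoˡ-≤ 2 (deg-monOf (M ─ f∈M)))
    (subst (_≤ k) (sym (trans (NP.+-comm (length (M ─ f∈M)) 2)
                              (cong suc (trans (sym (length-─ M f∈M)) |M|≡d)))) d<k)

  boolEntry : ∀ {e} → e ∈ M → Poly n × Axiom n
  boolEntry {e} e∈M =
    ((-q r , monOf (M ─ e∈M)) ∷ []) , bool (proj₁ e) (proj₂ e) (FinP.<⇒≢ (isEdge-∈M e∈M))

  wedgeOf : ∀ {e f} → IsEdge e → e ∉ M → f ∈ M → ¬ VertexDisjoint e f → Wedge e f
  wedgeOf {e} {f} e-edge e∉M f∈M meet =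
    wedge e f e-edge (isEdge-∈M f∈M) (λ e≡f → e∉M (subst (_∈ M) (sym e≡f) f∈M)) meet

  wedgeEntry : ∀ {e f} → IsEdge e → e ∉ M → f ∈ M → ¬ VertexDisjoint e f → Poly n × Axiom n
  wedgeEntry e-edge e∉M f∈M meet =
    ((-q r , monOf (M ─ f∈M)) ∷ []) , Wedge.axiom (wedgeOf e-edge e∉M f∈M meet)

  touchingEntry : ∀ {e} → IsEdge e → e ∉ M → (∃ λ f → f ∈ M × ¬ VertexDisjoint e f) → Poly n × Axiom n
  touchingEntry e-edge e∉M (f , f∈M , meet) = wedgeEntry e-edge e∉M f∈M meet

  entriesFor : ∀ e → Dec (IsEdge e) → Dec (e ∈ M) → Dec (All (VertexDisjoint e) M) → List (Poly n × Axiom n)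
  entriesFor e (no _) _ _ = []
  entriesFor e (yes _) (yes e∈M) _ = boolEntry e∈M ∷ []
  entriesFor e (yes _) (no _) (yes _) = []
  entriesFor e (yes e-edge) (no e∉M) (no meets) =
    touchingEntry e-edge e∉M (find (AllP.¬All⇒Any¬ (VertexDisjoint? e) M meets)) ∷ []

  correction : Edge n → List (Poly n × Axiom n)
  correction e = entriesFor e (isEdge? e) (e ∈ₑ? M) (All.all? (VertexDisjoint? e) M)

  boolEntry-coeff : ∀ {e} (e∈M : e ∈ M) m →
    coeff (weighted (boolEntry e∈M)) m ≡ (-q r) *q g m e +q (-q (-q r)) *q δ m μM
  boolEntry-coeff {e} e∈M m =
    trans (coeff-bool (-q r) (monOf (M ─ e∈M)) (proj₁ e) (proj₂ e) (FinP.<⇒≢ (isEdge-∈M e∈M)) m)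
      (cong₂ (λ y z → (-q r) *q y +q (-q (-q r)) *q z)
        (δ-cong m _ _ (λ a b → trans (cong (λ f → monOf (M ─ e∈M) a b N.+ (varMon f a b N.+ varMon f a b)) canonical)
                                     (trans (sym (NP.+-assoc (monOf (M ─ e∈M) a b) (varMon e a b) (varMon e a b)))
                                            (cong (N._+ varMon e a b) (removed-· e∈M a b)))))
        (δ-cong m _ _ (λ a b → trans (cong (λ f → monOf (M ─ e∈M) a b N.+ varMon f a b) canonical)
                                     (removed-· e∈M a b))))
    where
    canonical : edge (proj₁ e) (proj₂ e) ≡ e
    canonical = edge-canonical e (isEdge-∈M e∈M)

  wedgeEntry-coeff : ∀ {e f : Edge n} (e-edge : IsEdge e) (e∉M : e ∉ M) (f∈M : f ∈ M) (meet : ¬ VertexDisjoint e f) m →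
    coeff (weighted (wedgeEntry e-edge e∉M f∈M meet)) m ≡ (-q r) *q g m e
  wedgeEntry-coeff {e} {f} e-edge e∉M f∈M meet m =
    trans (coeff-wedge (wedgeOf e-edge e∉M f∈M meet) (-q r) (monOf (M ─ f∈M)) m)
      (cong ((-q r) *q_) (δ-cong m _ _ (λ a b →
        trans (sym (NP.+-assoc (monOf (M ─ f∈M) a b) (varMon f a b) (varMon e a b)))
              (cong (N._+ varMon e a b) (removed-· f∈M a b)))))

  extendBy-no : ∀ e → ¬ All (VertexDisjoint e) M → ∀ m → coeff (extendBy M e) m ≡ 0ℚ
  extendBy-no e meets m = cong (λ b → coeff (if b then xM (e ∷ M) else []) m)
    (dec-false (extends? M e) (meets ∘ proj₂))

  extendBy-yes : ∀ e → IsEdge e → All (VertexDisjoint e) M → ∀ m → coeff (extendBy M e) m ≡ g m e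
  extendBy-yes e e-edge disjoint m =
    trans (cong (λ b → coeff (if b then xM (e ∷ M) else []) m) (dec-true (extends? M e) (e-edge , disjoint)))
      (trans (coeff-xM (e ∷ M) m) (δ-cong m _ _ (λ a b →
        trans (cong (λ f → varMon f a b N.+ μM a b) (edge-canonical e e-edge)) (NP.+-comm (varMon e a b) (μM a b)))))

  entries-balance : ∀ e ie (me : Dec (e ∈ M)) de → IsEdge e → ∀ m →
    residue (entriesFor e ie me de) m +q r *q g m e ≡
      r *q coeff (extendBy M e) m +q r *q (if does me then δ m μM else 0ℚ)
  entries-balance e (no ¬edge) _ _ e-edge m = ⊥-elim (¬edge e-edge)
  entries-balance e (yes _) (yes e∈M) _ e-edge m = begin
        (coeff (weighted (boolEntry e∈M)) m +q 0ℚ) +q r *q g m e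
          ≡⟨ cong (λ y → (y +q 0ℚ) +q r *q g m e) (boolEntry-coeff e∈M m) ⟩
        ((-q r) *q g m e +q (-q (-q r)) *q δ m μM +q 0ℚ) +q r *q g m e
          ≡⟨ solve 3 (λ R G Δ → (((:- R) :* G :+ (:- (:- R)) :* Δ) :+ con 0ℚ) :+ R :* G
                               := R :* con 0ℚ :+ R :* Δ) refl r (g m e) (δ m μM) ⟩
        r *q 0ℚ +q r *q δ m μM
          ≡⟨ cong (λ y → r *q y +q r *q δ m μM)
               (sym (extendBy-no e (λ disjoint → VertexDisjoint-irrefl e (All.lookup disjoint e∈M)) m)) ⟩
        r *q coeff (extendBy M e) m +q r *q δ m μM ∎
    where
    open ≡-Reasoning
    open +-*-Solver
  entries-balance e (yes _) (no _) (yes disjoint) e-edge m = begin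
        0ℚ +q r *q g m e
          ≡⟨ solve 2 (λ R G → con 0ℚ :+ R :* G := R :* G :+ R :* con 0ℚ) refl r (g m e) ⟩
        r *q g m e +q r *q 0ℚ
          ≡⟨ cong (λ y → r *q y +q r *q 0ℚ) (sym (extendBy-yes e e-edge disjoint m)) ⟩
        r *q coeff (extendBy M e) m +q r *q 0ℚ ∎
    where
    open ≡-Reasoning
    open +-*-Solver
  entries-balance e (yes e-edge) (no e∉M) (no meets) _ m
      with find (AllP.¬All⇒Any¬ (VertexDisjoint? e) M meets)
  ... | f , f∈M , meet = begin
        (coeff (weighted (wedgeEntry e-edge e∉M f∈M meet)) m +q 0ℚ) +q r *q g m e
          ≡⟨ cong (λ y → (y +q 0ℚ) +q r *q g m e) (wedgeEntry-coeff e-edge e∉M f∈M meet m) ⟩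
        ((-q r) *q g m e +q 0ℚ) +q r *q g m e
          ≡⟨ solve 2 (λ R G → ((:- R) :* G :+ con 0ℚ) :+ R :* G := R :* con 0ℚ :+ R :* con 0ℚ) refl r (g m e) ⟩
        r *q 0ℚ +q r *q 0ℚ
          ≡⟨ cong (λ y → r *q y +q r *q 0ℚ) (sym (extendBy-no e meets m)) ⟩
        r *q coeff (extendBy M e) m +q r *q 0ℚ ∎
    where
    open ≡-Reasoning
    open +-*-Solver

  entries-degrees : ∀ e ie me de → All (λ qa → DegLe (weighted qa) k) (entriesFor e ie me de)
  entries-degrees e (no _) _ _ = []
  entries-degrees e (yes _) (yes e∈M) _ = degLe-monomial-* (-q r) (monOf (M ─ e∈M)) _ k
    (bool-degrees (monOf (M ─ e∈M)) (proj₁ e) (proj₂ e) (FinP.<⇒≢ (isEdge-∈M e∈M)) k (removed-bound e∈M)) ∷ []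
  entries-degrees e (yes _) (no _) (yes _) = []
  entries-degrees e (yes e-edge) (no e∉M) (no meets) with find (AllP.¬All⇒Any¬ (VertexDisjoint? e) M meets)
  ... | f , f∈M , meet = degLe-monomial-* (-q r) (monOf (M ─ f∈M)) _ k
    (wedge-degrees (wedgeOf e-edge e∉M f∈M meet) (monOf (M ─ f∈M)) k (removed-bound f∈M)) ∷ []

  covers : List (Poly n × Axiom n)
  covers = map (λ v → ((r *q ½ , μM) ∷ []) , cover v) (allFin n)

  corrections : List (Poly n × Axiom n)
  corrections = concatMap correction (allEdges n)

  residue-corrections : ∀ m → residue corrections m ≡
    (r *q ∑ℚ (allEdges n) (λ e → coeff (extendBy M e) m) +q r *q (ι d *q δ m μM)) +q (-q r) *q ∑ℚ (allEdges n) (g m)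
  residue-corrections m = begin
      residue corrections m
        ≡⟨ ∑ℚ.∑-concatMap correction A _ ⟩
      ∑ℚ A (λ e → residue (correction e) m)
        ≡⟨ ∑ℚ.∑-cong-∈ A (λ e e∈A → isolate (entries-balance e (isEdge? e) (e ∈ₑ? M) (All.all? (VertexDisjoint? e) M)
                                                               (allEdges-isEdge e∈A) m)) ⟩
      ∑ℚ A (λ e → (r *q coeff (extendBy M e) m +q r *q inM e) +q (-q r) *q g m e)
        ≡⟨ trans (∑ℚ.∑-⊕ A _ _) (cong (_+q ∑ℚ A (λ e → (-q r) *q g m e)) (∑ℚ.∑-⊕ A _ _)) ⟩
      (∑ℚ A (λ e → r *q coeff (extendBy M e) m) +q ∑ℚ A (λ e → r *q inM e)) +q ∑ℚ A (λ e → (-q r) *q g m e)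
        ≡⟨ cong₂ _+q_ (cong₂ _+q_ (∑ℚ-* A r _) (trans (∑ℚ-* A r inM) (cong (r *q_) ∑-inM)))
                      (∑ℚ-* A (-q r) (g m)) ⟩
      (r *q ∑ℚ A (λ e → coeff (extendBy M e) m) +q r *q (ι d *q δ m μM)) +q (-q r) *q ∑ℚ A (g m) ∎
    where
    open ≡-Reasoning
    A = allEdges n
    inM : Edge n → ℚ
    inM e = if does (e ∈ₑ? M) then δ m μM else 0ℚ
    isolate : ∀ {R G X : ℚ} → R +q r *q G ≡ X → R ≡ X +q (-q r) *q G
    isolate {R} {G} {X} eq = trans (solve 3 (λ R′ r′ G′ → R′ := (R′ :+ r′ :* G′) :+ (:- r′) :* G′) refl R r G)
                                   (cong (_+q (-q r) *q G) eq)
      where open +-*-Solver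
    ∑-inM : ∑ℚ A inM ≡ ι d *q δ m μM
    ∑-inM = trans (Restrict.∑-restrict QP.+-0-isCommutativeMonoid _≟ₑ_ A M (λ _ → δ m μM)
                     (allEdges-unique n) (matching-unique mat) (matching-⊆-allEdges mat))
                  (trans (∑ℚ-const M (δ m μM)) (cong (λ l → ι l *q δ m μM) |M|≡d))

  covers-degrees : All (λ qa → DegLe (weighted qa) k) covers
  covers-degrees = AllP.map⁺ (All.universal (λ v → degLe-monomial-* (r *q ½) μM _ k
    (cover-degrees μM v k (NP.≤-trans (NP.+-monoˡ-≤ 1 (deg-monOf M))
      (subst (λ l → l N.+ 1 ≤ k) (sym |M|≡d) (subst (_≤ k) (NP.+-comm 1 d) d<k))))) (allFin n))

  corrections-degrees : All (λ qa → DegLe (weighted qa) k) corrections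
  corrections-degrees = AllP.concat⁺ (AllP.map⁺ (All.universal (λ e → entries-degrees e _ _ _) (allEdges n)))

  step : ∀ h → n ≡ 2 * h → d ≤ h → r *q ι (h ∸ d) ≡ 1ℚ →
    DerivEq n k (xM M) (scale r (sumₚ (map (extendBy M) (allEdges n))))
  step h n≡2h d≤h r-inverse = derivation {F = xM M} {G = scale r (sumₚ (map (extendBy M) A))}
    (covers ++ corrections) balanced (AllP.++⁺ covers-degrees corrections-degrees)
    where
    A = allEdges n
    n-split : ι n ≡ (ι (h ∸ d) +q ι d) +q (ι (h ∸ d) +q ι d)
    n-split = trans (cong ι n≡2h) (trans (ι-+ h (h N.+ 0))
      (cong₂ _+q_ h-split (trans (cong ι (NP.+-identityʳ h)) h-split)))
      where h-split = trans (cong ι (sym (NP.m∸n+n≡m d≤h))) (ι-+ (h ∸ d) d)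
    balanced : ∀ m → coeff (xM M) m +q residue (covers ++ corrections) m ≡ coeff (scale r (sumₚ (map (extendBy M) A))) m
    balanced m = begin
        coeff (xM M) m +q residue (covers ++ corrections) m
          ≡⟨ cong₂ _+q_ (coeff-xM M m) (∑ℚ.∑-++ covers corrections _) ⟩
        δM +q (residue covers m +q residue corrections m)
          ≡⟨ cong₂ (λ y z → δM +q (y +q z)) (trans (∑ℚ.∑-map _ (allFin n) _) (coeff-covers (r *q ½) μM m))
                                             (residue-corrections m) ⟩
        δM +q ((r *q ½) *q ((GA +q GA) +q ι n *q ((-q 1ℚ) *q δM)) +q ((r *q ΣF +q r *q (ι d *q δM)) +q (-q r) *q GA))
          ≡⟨ cong (λ t → δM +q ((r *q ½) *q ((GA +q GA) +q t *q ((-q 1ℚ) *q δM))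
                              +q ((r *q ΣF +q r *q (ι d *q δM)) +q (-q r) *q GA))) n-split ⟩
        δM +q ((r *q ½) *q ((GA +q GA) +q ((ι (h ∸ d) +q ι d) +q (ι (h ∸ d) +q ι d)) *q ((-q 1ℚ) *q δM))
               +q ((r *q ΣF +q r *q (ι d *q δM)) +q (-q r) *q GA))
          ≡⟨ step-algebra r (ι (h ∸ d)) (ι d) δM GA ΣF r-inverse ⟩
        r *q ΣF
          ≡⟨ sym (trans (coeff-scale r (sumₚ (map (extendBy M) A)) m) (cong (r *q_) (coeff-sumₚ (extendBy M) A m))) ⟩
        coeff (scale r (sumₚ (map (extendBy M) A))) m ∎
      where
      open ≡-Reasoning
      δM = δ m μM
      GA = ∑ℚ A (g m)
      ΣF = ∑ℚ A (λ e → coeff (extendBy M e) m)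

oneEdgeStep : ∀ {n} h → n ≡ 2 * h → (M : List (Edge n)) → IsMatching M →
  ∀ d k → length M ≡ d → suc d ≤ k → k ≤ h →
  DerivEq n k (xM M) (scale (recip (h ∸ d)) (sumₚ (map (extendBy M) (allEdges n))))
oneEdgeStep h n≡2h M mat d k |M|≡d d<k k≤h =
  OneEdgeStep.step M mat d k |M|≡d d<k (recip (h ∸ d)) h n≡2h (NP.<⇒≤ d<h)
    (subst (λ l → recip l *q ι l ≡ 1ℚ) (sym (NP.+-∸-assoc 1 d<h)) (recip-inverse (h ∸ suc d)))
  where
  d<h : suc d ≤ h
  d<h = NP.≤-trans d<k k≤h

if-ind : ∀ b y → (if b then y else 0ℚ) ≡ ind b *q y
if-ind true y = sym (QP.*-identityˡ y)
if-ind false y = sym (QP.*-zeroˡ y)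

module Sublists {X : Set} (_≟_ : DecidableEquality X) where
  open import Data.List.Membership.DecPropositional _≟_ using (_∈?_)

  sublists-⊆ : ∀ {S : List X} A → S ∈ sublists A → All (_∈ A) S
  sublists-⊆ [] (here refl) = []
  sublists-⊆ (a ∷ A) S∈ with ∈P.∈-++⁻ (sublists A) S∈
  ... | inj₁ S∈′ = All.map there (sublists-⊆ A S∈′)
  ... | inj₂ aS∈ with ∈P.∈-map⁻ (a ∷_) aS∈
  ...   | S′ , S′∈ , refl = here refl ∷ All.map there (sublists-⊆ A S′∈)

  sublists-unique : ∀ {S : List X} A → Unique A → S ∈ sublists A → Unique S
  sublists-unique [] _ (here refl) = []
  sublists-unique (a ∷ A) (a∉ ∷ u) S∈ with ∈P.∈-++⁻ (sublists A) S∈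
  ... | inj₁ S∈′ = sublists-unique A u S∈′
  ... | inj₂ aS∈ with ∈P.∈-map⁻ (a ∷_) aS∈
  ...   | S′ , S′∈ , refl =
    All.map (λ b∈ a≡b → All.lookup a∉ b∈ a≡b) (sublists-⊆ A S′∈) ∷ sublists-unique A u S′∈

  Selects : List X → List X → (X → Bool) → Set
  Selects A S g = All (λ a → does (a ∈? S) ≡ g a) A

  selects? : ∀ A S g → Dec (Selects A S g)
  selects? A S g = All.all? (λ a → does (a ∈? S) Data.Bool.Properties.≟ g a) A

  ∑-sublists-selects : ∀ A → Unique A → (g : X → Bool) (ψ : List X → ℚ) →
    ∑ℚ (sublists A) (λ S → ind (does (selects? A S g)) *q ψ S) ≡ ψ (filterᵇ g A)
  ∑-sublists-selects [] _ g ψ = trans (QP.+-identityʳ _) (QP.*-identityˡ _)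
  ∑-sublists-selects (a ∷ A) (a∉ ∷ u) g ψ = begin
      ∑ℚ (sublists A ++ map (a ∷_) (sublists A)) term
        ≡⟨ trans (∑ℚ.∑-++ (sublists A) _ term)
                 (cong (∑ℚ (sublists A) term +q_) (∑ℚ.∑-map (a ∷_) (sublists A) term)) ⟩
      ∑ℚ (sublists A) term +q ∑ℚ (sublists A) (λ S → term (a ∷ S))
        ≡⟨ cong₂ _+q_ (∑ℚ.∑-cong-∈ (sublists A) (λ S S∈ →
                         cong (λ b → ind (does (b Data.Bool.Properties.≟ g a) ∧ does (selects? A S g)) *q ψ S)
                              (dec-false (a ∈? S) (λ a∈S → All.lookup a∉ (All.lookup (sublists-⊆ A S∈) a∈S) refl))))
                      (∑ℚ.∑-cong (sublists A) (λ S →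
                         cong₂ (λ b c → ind (does (b Data.Bool.Properties.≟ g a) ∧ c) *q ψ (a ∷ S))
                               (dec-true (a ∈? (a ∷ S)) (here refl))
                               (does-⇔ (mk⇔ (λ sel → All.tabulate (λ e∈A →
                                                      trans (sym (dropHead {S} e∈A)) (All.lookup sel e∈A)))
                                             (λ sel → All.tabulate (λ e∈A →
                                                      trans (dropHead {S} e∈A) (All.lookup sel e∈A))))
                                       (selects? A (a ∷ S) g) (selects? A S g)))) ⟩
      ∑ℚ (sublists A) (λ S → ind (does (false Data.Bool.Properties.≟ g a) ∧ does (selects? A S g)) *q ψ S)
        +q ∑ℚ (sublists A) (λ S → ind (does (true Data.Bool.Properties.≟ g a) ∧ does (selects? A S g)) *q ψ (a ∷ S))
        ≡⟨ byHead ⟩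
      ψ (filterᵇ g (a ∷ A)) ∎
    where
    open ≡-Reasoning
    term : List X → ℚ
    term S = ind (does (selects? (a ∷ A) S g)) *q ψ S
    dropHead : ∀ {S e} → e ∈ A → does (e ∈? (a ∷ S)) ≡ does (e ∈? S)
    dropHead {S} {e} e∈A = does-⇔ (mk⇔ strip there) (e ∈? (a ∷ S)) (e ∈? S)
      where
      strip : e ∈ a ∷ S → e ∈ S
      strip (here e≡a) = ⊥-elim (All.lookup a∉ e∈A (sym e≡a))
      strip (there e∈S) = e∈S
    vanish : (ψ′ : List X → ℚ) → ∑ℚ (sublists A) (λ S → ind false *q ψ′ S) ≡ 0ℚ
    vanish ψ′ = trans (∑ℚ.∑-cong (sublists A) (λ S → QP.*-zeroˡ (ψ′ S))) (∑ℚ.∑-zero (sublists A))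
    byHead : ∑ℚ (sublists A) (λ S → ind (does (false Data.Bool.Properties.≟ g a) ∧ does (selects? A S g)) *q ψ S)
             +q ∑ℚ (sublists A) (λ S → ind (does (true Data.Bool.Properties.≟ g a) ∧ does (selects? A S g)) *q ψ (a ∷ S))
             ≡ ψ (filterᵇ g (a ∷ A))
    byHead with g a
    ... | true = trans (cong₂ _+q_ (vanish ψ) (∑-sublists-selects A u g (ψ ∘ (a ∷_)))) (QP.+-identityˡ _)
    ... | false = trans (cong₂ _+q_ (∑-sublists-selects A u g ψ) (vanish (ψ ∘ (a ∷_)))) (QP.+-identityʳ _)

-- Extensions of a matching: the base case and double counting

does-transfer : ∀ {P Q : Set} (p : Dec P) (q : Dec Q) → does p ≡ does q → P → Q
does-transfer (yes _) (yes q) _ _ = q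
does-transfer (no ¬p) _ _ p = ⊥-elim (¬p p)

module Extensions {n : ℕ} where
  open Sublists (_≟ₑ_ {n})

  AE : List (Edge n)
  AE = allEdges n

  isExtension? : (M : List (Edge n)) (k : ℕ) (S : List (Edge n)) → Dec (IsMatching S × M ⊆ₑ S × length S ≡ k)
  isExtension? M k S = IsMatching? S ×-dec (M ⊆ₑ? S) ×-dec (length S N.≟ k)

  coeff-extSum : ∀ M k m →
    coeff (extSum n M k) m ≡ ∑ℚ (sublists AE) (λ S → ind (does (isExtension? M k S)) *q coeff (xM S) m)
  coeff-extSum M k m = trans (coeff-sumₚ xM (extensions n M k) m)
    (trans (∑ℚ.∑-filter (isExtension? M k) (sublists AE) _)
           (∑ℚ.∑-cong (sublists AE) (λ S → if-ind (does (isExtension? M k S)) (coeff (xM S) m))))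

  extension-selects : ∀ M k → IsMatching M → length M ≡ k → ∀ S → S ∈ sublists AE →
    does (isExtension? M k S) ≡ does (selects? AE S (λ e → does (e ∈ₑ? M)))
  extension-selects M k mat |M|≡k S S∈ = does-⇔ (mk⇔ toSelects fromSelects) (isExtension? M k S) (selects? AE S _)
    where
    uM = matching-unique mat
    toSelects : IsMatching S × M ⊆ₑ S × length S ≡ k → Selects AE S (λ e → does (e ∈ₑ? M))
    toSelects (_ , M⊆S , |S|≡k) = All.tabulate (λ {e} _ →
      does-⇔ (mk⇔ (⊆-of-length _≟ₑ_ uM M⊆S (NP.≤-reflexive (trans |S|≡k (sym |M|≡k)))) (All.lookup M⊆S))
             (e ∈ₑ? S) (e ∈ₑ? M))
    fromSelects : Selects AE S (λ e → does (e ∈ₑ? M)) → IsMatching S × M ⊆ₑ S × length S ≡ k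
    fromSelects sel = (All.map allEdges-isEdge S⊆AE , allPairs-tabulate S uS disjoint) , All.tabulate M→S ,
      trans (NP.≤-antisym (unique-⊆-length S M uS (All.tabulate S→M)) (unique-⊆-length M S uM (All.tabulate M→S))) |M|≡k
      where
      S⊆AE = sublists-⊆ AE S∈
      uS = sublists-unique AE (allEdges-unique n) S∈
      S→M : ∀ {e} → e ∈ S → e ∈ M
      S→M {e} e∈S = does-transfer (e ∈ₑ? S) (e ∈ₑ? M) (All.lookup sel (All.lookup S⊆AE e∈S)) e∈S
      M→S : ∀ {e} → e ∈ M → e ∈ S
      M→S {e} e∈M = does-transfer (e ∈ₑ? M) (e ∈ₑ? S)
        (sym (All.lookup sel (All.lookup (matching-⊆-allEdges mat) e∈M))) e∈M
      disjoint : ∀ {e f} → e ∈ S → f ∈ S → e ≢ f → VertexDisjoint e f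
      disjoint e∈S f∈S = matching-disjoint mat (S→M e∈S) (S→M f∈S)

  extSum-base : ∀ M k → IsMatching M → length M ≡ k → ∀ m → coeff (extSum n M k) m ≡ coeff (xM M) m
  extSum-base M k mat |M|≡k m = begin
      coeff (extSum n M k) m
        ≡⟨ coeff-extSum M k m ⟩
      ∑ℚ (sublists AE) (λ S → ind (does (isExtension? M k S)) *q coeff (xM S) m)
        ≡⟨ ∑ℚ.∑-cong-∈ (sublists AE) (λ S S∈ → cong (λ b → ind b *q coeff (xM S) m)
                                                      (extension-selects M k mat |M|≡k S S∈)) ⟩
      ∑ℚ (sublists AE) (λ S → ind (does (selects? AE S inM)) *q coeff (xM S) m)
        ≡⟨ ∑-sublists-selects AE (allEdges-unique n) inM (λ S → coeff (xM S) m) ⟩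
      coeff (xM (filterᵇ inM AE)) m
        ≡⟨ trans (coeff-xM (filterᵇ inM AE) m) (trans (δ-cong m _ _ sameMonomial) (sym (coeff-xM M m))) ⟩
      coeff (xM M) m ∎
    where
    open ≡-Reasoning
    inM : Edge n → Bool
    inM e = does (e ∈ₑ? M)
    sameMonomial : ∀ a b → monOf (filterᵇ inM AE) a b ≡ monOf M a b
    sameMonomial a b = trans (monOf-∑ (filterᵇ inM AE) a b) (trans (∑ℕ.∑-filter (λ e → Data.Bool.T? (inM e)) AE _)
      (trans (Restrict.∑-restrict NP.+-0-isCommutativeMonoid _≟ₑ_ AE M (λ e → varMon (edge (proj₁ e) (proj₂ e)) a b)
                (allEdges-unique n) (matching-unique mat) (matching-⊆-allEdges mat))
             (sym (monOf-∑ M a b))))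

  count-new-edges : ∀ M d k → IsMatching M → length M ≡ d → ∀ S → IsMatching S → M ⊆ₑ S → length S ≡ k →
    ∑ℚ AE (λ e → ind (does (extends? M e)) *q ind (does (e ∈ₑ? S))) ≡ ι k +q (-q 1ℚ) *q ι d
  count-new-edges M d k mat |M|≡d S matS M⊆S |S|≡k = begin
      ∑ℚ AE (λ e → ind (does (extends? M e)) *q ind (does (e ∈ₑ? S)))
        ≡⟨ ∑ℚ.∑-cong AE (λ e → trans (QP.*-comm (ind (does (extends? M e))) (ind (does (e ∈ₑ? S))))
                                           (sym (if-ind (does (e ∈ₑ? S)) (ind (does (extends? M e)))))) ⟩
      ∑ℚ AE (λ e → if does (e ∈ₑ? S) then ind (does (extends? M e)) else 0ℚ)
        ≡⟨ Restrict.∑-restrict QP.+-0-isCommutativeMonoid _≟ₑ_ AE S _ (allEdges-unique n) uS (matching-⊆-allEdges matS) ⟩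
      ∑ℚ S (λ e → ind (does (extends? M e)))
        ≡⟨ ∑ℚ.∑-cong-∈ S (λ e e∈S → new e e∈S (e ∈ₑ? M)) ⟩
      ∑ℚ S (λ e → 1ℚ +q (-q 1ℚ) *q ind (does (e ∈ₑ? M)))
        ≡⟨ trans (∑ℚ.∑-⊕ S _ _) (cong₂ _+q_ (∑ℚ-const S 1ℚ) (∑ℚ-* S (-q 1ℚ) _)) ⟩
      ι (length S) *q 1ℚ +q (-q 1ℚ) *q ∑ℚ S (λ e → ind (does (e ∈ₑ? M)))
        ≡⟨ cong (λ y → ι (length S) *q 1ℚ +q (-q 1ℚ) *q y)
             (trans (Restrict.∑-restrict QP.+-0-isCommutativeMonoid _≟ₑ_ S M (λ _ → 1ℚ) uS (matching-unique mat) M⊆S)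
                    (∑ℚ-const M 1ℚ)) ⟩
      ι (length S) *q 1ℚ +q (-q 1ℚ) *q (ι (length M) *q 1ℚ)
        ≡⟨ cong₂ (λ y z → y +q (-q 1ℚ) *q z) (trans (QP.*-identityʳ _) (cong ι |S|≡k))
                                              (trans (QP.*-identityʳ _) (cong ι |M|≡d)) ⟩
      ι k +q (-q 1ℚ) *q ι d ∎
    where
    open ≡-Reasoning
    uS = matching-unique matS
    new : ∀ e → e ∈ S → (e∈?M : Dec (e ∈ M)) → ind (does (extends? M e)) ≡ 1ℚ +q (-q 1ℚ) *q ind (does e∈?M)
    new e e∈S (yes e∈M) = cong ind (dec-false (extends? M e)
      (λ ext → VertexDisjoint-irrefl e (All.lookup (proj₂ ext) e∈M)))
    new e e∈S (no e∉M) = cong ind (dec-true (extends? M e) (All.lookup (proj₁ matS) e∈S ,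
      All.tabulate (λ f∈M → matching-disjoint matS e∈S (All.lookup M⊆S f∈M)
                                              (λ e≡f → e∉M (subst (_∈ M) (sym e≡f) f∈M)))))

  extendSum : List (Edge n) → ℕ → ℚ → Edge n → Poly n
  extendSum M k c e = if does (extends? M e) then scale c (extSum n (e ∷ M) k) else []

  isExtension-∷ : ∀ e M k S →
    ind (does (isExtension? (e ∷ M) k S)) ≡ ind (does (e ∈ₑ? S)) *q ind (does (isExtension? M k S))
  isExtension-∷ e M k S = pull (does (IsMatching? S)) (does (e ∈ₑ? S)) (does (M ⊆ₑ? S)) (does (length S N.≟ k))
    where
    pull : ∀ bm be bs bl → ind (bm ∧ ((be ∧ bs) ∧ bl)) ≡ ind be *q ind (bm ∧ (bs ∧ bl))
    pull false be bs bl = sym (QP.*-zeroʳ (ind be))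
    pull true true bs bl = sym (QP.*-identityˡ (ind (bs ∧ bl)))
    pull true false bs bl = sym (QP.*-zeroˡ (ind (bs ∧ bl)))

  coeff-extendSum : ∀ M k c e m → coeff (extendSum M k c e) m ≡
    ∑ℚ (sublists AE) (λ S → (c *q coeff (xM S) m)
                             *q (ind (does (extends? M e)) *q ind (does (isExtension? (e ∷ M) k S))))
  coeff-extendSum M k c e m = begin
      coeff (extendSum M k c e) m
        ≡⟨ trans (coeff-if (does (extends? M e)) (scale c (extSum n (e ∷ M) k)) m)
             (cong (D *q_) (trans (coeff-scale c (extSum n (e ∷ M) k) m) (cong (c *q_) (coeff-extSum (e ∷ M) k m)))) ⟩
      D *q (c *q ∑ℚ (sublists AE) (λ S → ind (does (isExtension? (e ∷ M) k S)) *q φ S))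
        ≡⟨ trans (sym (QP.*-assoc D c _)) (sym (∑ℚ-* (sublists AE) (D *q c) _)) ⟩
      ∑ℚ (sublists AE) (λ S → (D *q c) *q (ind (does (isExtension? (e ∷ M) k S)) *q φ S))
        ≡⟨ ∑ℚ.∑-cong (sublists AE) (λ S → solve 4 (λ a b c d → (a :* b) :* (c :* d) := (b :* d) :* (a :* c))
                                        refl D c (ind (does (isExtension? (e ∷ M) k S))) (φ S)) ⟩
      ∑ℚ (sublists AE) (λ S → (c *q φ S) *q (D *q ind (does (isExtension? (e ∷ M) k S)))) ∎
    where
    open ≡-Reasoning
    open +-*-Solver
    D = ind (does (extends? M e))
    φ : List (Edge n) → ℚ
    φ S = coeff (xM S) m

  count-extending-edges : ∀ M d k s → IsMatching M → length M ≡ d → ι k ≡ ι s +q ι d → ∀ S →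
    ∑ℚ AE (λ e → ind (does (extends? M e)) *q ind (does (isExtension? (e ∷ M) k S)))
      ≡ ι s *q ind (does (isExtension? M k S))
  count-extending-edges M d k s mat |M|≡d k≡s+d S = begin
      ∑ℚ AE (λ e → D e *q ind (does (isExtension? (e ∷ M) k S)))
        ≡⟨ ∑ℚ.∑-cong AE (λ e → trans (cong (D e *q_) (isExtension-∷ e M k S))
             (trans (sym (QP.*-assoc (D e) _ P)) (QP.*-comm _ P))) ⟩
      ∑ℚ AE (λ e → P *q (D e *q ind (does (e ∈ₑ? S))))
        ≡⟨ trans (∑ℚ-* AE P _) (QP.*-comm P _) ⟩
      newEdges *q P
        ≡⟨ onExtensions (isExtension? M k S) ⟩
      ι s *q P ∎
    where
    open ≡-Reasoning
    D : Edge n → ℚ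
    D e = ind (does (extends? M e))
    P = ind (does (isExtension? M k S))
    newEdges = ∑ℚ AE (λ e → D e *q ind (does (e ∈ₑ? S)))
    onExtensions : (p : Dec (IsMatching S × M ⊆ₑ S × length S ≡ k)) → newEdges *q ind (does p) ≡ ι s *q ind (does p)
    onExtensions (yes (matS , M⊆S , |S|≡k)) = cong (_*q 1ℚ)
      (trans (count-new-edges M d k mat |M|≡d S matS M⊆S |S|≡k)
        (trans (cong (_+q (-q 1ℚ) *q ι d) k≡s+d)
          (solve 2 (λ a b → (a :+ b) :+ (:- con 1ℚ) :* b := a) refl (ι s) (ι d))))
      where open +-*-Solver
    onExtensions (no _) = trans (QP.*-zeroʳ newEdges) (sym (QP.*-zeroʳ (ι s)))

  -- double counting: each k-edge extension of M arises from exactly its k − d edges outside M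
  double-count : ∀ M d k s → IsMatching M → length M ≡ d → ι k ≡ ι s +q ι d → ∀ c m →
    coeff (sumₚ (map (extendSum M k c) AE)) m ≡ (c *q ι s) *q coeff (extSum n M k) m
  double-count M d k s mat |M|≡d k≡s+d c m = begin
      coeff (sumₚ (map (extendSum M k c) AE)) m
        ≡⟨ trans (coeff-sumₚ (extendSum M k c) AE m) (∑ℚ.∑-cong AE (λ e → coeff-extendSum M k c e m)) ⟩
      ∑ℚ AE (λ e → ∑ℚ SUB (λ S → (c *q φ S) *q (D e *q ind (does (isExtension? (e ∷ M) k S)))))
        ≡⟨ ∑ℚ.∑-swap AE SUB _ ⟩
      ∑ℚ SUB (λ S → ∑ℚ AE (λ e → (c *q φ S) *q (D e *q ind (does (isExtension? (e ∷ M) k S)))))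
        ≡⟨ ∑ℚ.∑-cong SUB (λ S → trans (∑ℚ-* AE (c *q φ S) _)
             (cong ((c *q φ S) *q_) (count-extending-edges M d k s mat |M|≡d k≡s+d S))) ⟩
      ∑ℚ SUB (λ S → (c *q φ S) *q (ι s *q P S))
        ≡⟨ trans (∑ℚ.∑-cong SUB (λ S → solve 4 (λ a b c d → (a :* b) :* (c :* d) := (a :* c) :* (d :* b))
                                                refl c (φ S) (ι s) (P S)))
                 (∑ℚ-* SUB (c *q ι s) _) ⟩
      (c *q ι s) *q ∑ℚ SUB (λ S → P S *q φ S)
        ≡⟨ cong ((c *q ι s) *q_) (sym (coeff-extSum M k m)) ⟩
      (c *q ι s) *q coeff (extSum n M k) m ∎
    where
    open ≡-Reasoning
    open +-*-Solver
    SUB = sublists AE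
    φ : List (Edge n) → ℚ
    φ S = coeff (xM S) m
    D : Edge n → ℚ
    D e = ind (does (extends? M e))
    P : List (Edge n) → ℚ
    P S = ind (does (isExtension? M k S))

-- Binomial coefficients

C-positive : ∀ a b → b ≤ a → ∃ λ c → a C b ≡ suc c
C-positive a zero _ = 0 , refl
C-positive (suc a) (suc b) (N.s≤s b≤a) with C-positive a b b≤a
... | c , aCb≡1+c = c N.+ a C suc b ,
  trans (sym (nCk+nC[k+1]≡[n+1]C[k+1] a b)) (cong (N._+ a C suc b) aCb≡1+c)

C-absorption : ∀ a b → suc b * (suc a C suc b) ≡ suc a * (a C b)
C-absorption a zero = trans (NP.+-identityʳ _) (trans (nC1≡n (suc a)) (sym (NP.*-identityʳ (suc a))))
C-absorption zero (suc b)
  rewrite k>n⇒nCk≡0 {1} {suc (suc b)} (N.s≤s (N.s≤s N.z≤n)) | k>n⇒nCk≡0 {0} {suc b} (N.s≤s N.z≤n) = NP.*-zeroʳ b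
C-absorption (suc a) (suc b) = begin
    suc (suc b) * (suc (suc a) C suc (suc b))
      ≡⟨ cong (suc (suc b) *_) (sym (nCk+nC[k+1]≡[n+1]C[k+1] (suc a) (suc b))) ⟩
    suc (suc b) * (suc a C suc b N.+ suc a C suc (suc b))
      ≡⟨ NP.*-distribˡ-+ (suc (suc b)) (suc a C suc b) (suc a C suc (suc b)) ⟩
    suc (suc b) * (suc a C suc b) N.+ suc (suc b) * (suc a C suc (suc b))
      ≡⟨ cong₂ N._+_ (cong (suc a C suc b N.+_) (C-absorption a b)) (C-absorption a (suc b)) ⟩
    (suc a C suc b N.+ suc a * (a C b)) N.+ suc a * (a C suc b)
      ≡⟨ NP.+-assoc (suc a C suc b) _ _ ⟩
    suc a C suc b N.+ (suc a * (a C b) N.+ suc a * (a C suc b))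
      ≡⟨ cong (suc a C suc b N.+_) (trans (sym (NP.*-distribˡ-+ (suc a) (a C b) (a C suc b)))
                                          (cong (suc a *_) (nCk+nC[k+1]≡[n+1]C[k+1] a b))) ⟩
    suc (suc a) * (suc a C suc b) ∎
  where open ≡-Reasoning

recip-ratio : ∀ p q s t → s * suc p ≡ suc q * suc t → (recip (suc q) *q recip (suc t)) *q ι s ≡ recip (suc p)
recip-ratio p q s t sP≡QT = begin
    (Q⁻¹ *q T⁻¹) *q ι s
      ≡⟨ cong ((Q⁻¹ *q T⁻¹) *q_) (sym (QP.*-identityʳ (ι s))) ⟩
    (Q⁻¹ *q T⁻¹) *q (ι s *q 1ℚ)
      ≡⟨ cong (λ y → (Q⁻¹ *q T⁻¹) *q (ι s *q y)) (sym (trans (QP.*-comm (ι (suc p)) P⁻¹) (recip-inverse p))) ⟩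
    (Q⁻¹ *q T⁻¹) *q (ι s *q (ι (suc p) *q P⁻¹))
      ≡⟨ cong (λ y → (Q⁻¹ *q T⁻¹) *q y) (trans (sym (QP.*-assoc (ι s) (ι (suc p)) P⁻¹))
           (cong (_*q P⁻¹) (trans (sym (ι-* s (suc p))) (trans (cong ι sP≡QT) (ι-* (suc q) (suc t)))))) ⟩
    (Q⁻¹ *q T⁻¹) *q ((ι (suc q) *q ι (suc t)) *q P⁻¹)
      ≡⟨ solve 5 (λ a b c d r → (a :* b) :* ((c :* d) :* r) := r :* ((a :* c) :* (b :* d))) refl
           Q⁻¹ T⁻¹ (ι (suc q)) (ι (suc t)) P⁻¹ ⟩
    P⁻¹ *q ((Q⁻¹ *q ι (suc q)) *q (T⁻¹ *q ι (suc t)))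
      ≡⟨ cong₂ (λ y z → P⁻¹ *q (y *q z)) (recip-inverse q) (recip-inverse t) ⟩
    P⁻¹ *q (1ℚ *q 1ℚ)
      ≡⟨ QP.*-identityʳ P⁻¹ ⟩
    P⁻¹ ∎
  where
  open ≡-Reasoning
  open +-*-Solver
  P⁻¹ = recip (suc p)
  Q⁻¹ = recip (suc q)
  T⁻¹ = recip (suc t)

binomial-step : ∀ a b → b ≤ a → (recip (suc a) *q recip (a C b)) *q ι (suc b) ≡ recip (suc a C suc b)
binomial-step a b b≤a with C-positive a b b≤a | C-positive (suc a) (suc b) (N.s≤s b≤a) | C-absorption a b
... | c , aCb≡1+c | c′ , a′Cb′≡1+c′ | absorption rewrite aCb≡1+c | a′Cb′≡1+c′ =
  recip-ratio c′ a (suc b) c absorption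

step-scalar : ∀ h d k → suc d ≤ k → k ≤ h →
  (recip (h ∸ d) *q recip ((h ∸ suc d) C (k ∸ suc d))) *q ι (k ∸ d) ≡ recip ((h ∸ d) C (k ∸ d))
step-scalar h d k d<k k≤h rewrite NP.+-∸-assoc 1 (NP.≤-trans d<k k≤h) | NP.+-∸-assoc 1 d<k =
  binomial-step (h ∸ suc d) (k ∸ suc d) (NP.∸-monoˡ-≤ (suc d) k≤h)

open Extensions using (extSum-base; extendSum; double-count)

extension-theorem : ∀ {n} h → n ≡ 2 * h → ∀ t (M : List (Edge n)) → IsMatching M →
  ∀ d k → length M ≡ d → t N.+ d ≡ k → k ≤ h →
  DerivEq n k (xM M) (scale (recip ((h ∸ d) C (k ∸ d))) (extSum n M k))
extension-theorem h n≡2h zero M mat d .d |M|≡d refl k≤h rewrite NP.n∸n≡0 d =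
  derivRefl {F = xM M} {G = scale 1ℚ (extSum _ M d)}
    (λ m → sym (trans (coeff-scale 1ℚ (extSum _ M d) m) (trans (QP.*-identityˡ _) (extSum-base M d mat |M|≡d m))))
extension-theorem {n} h n≡2h (suc t) M mat d k |M|≡d t+d≡k k≤h =
  derivTrans {F = xM M} {viaStep} {target} oneStep
    (derivTrans {F = viaStep} {viaIH} {target} inductionStep (derivRefl {F = viaIH} {target} counted))
  where
  AE = allEdges n
  r = recip (h ∸ d)
  r′ = recip ((h ∸ suc d) C (k ∸ suc d))
  viaStep = scale r (sumₚ (map (extendBy M) AE))
  viaIH = scale r (sumₚ (map (extendSum M k r′) AE))
  target = scale (recip ((h ∸ d) C (k ∸ d))) (extSum n M k)
  d<k : suc d ≤ k
  d<k = subst (suc d ≤_) t+d≡k (N.s≤s (NP.m≤n+m d t))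
  oneStep : DerivEq n k (xM M) viaStep
  oneStep = oneEdgeStep h n≡2h M mat d k |M|≡d d<k k≤h
  extended : ∀ e → DerivEq n k (extendBy M e) (extendSum M k r′ e)
  extended e = derivIf (extends? M e) (xM (e ∷ M)) (scale r′ (extSum n (e ∷ M) k))
    (λ (e-edge , e∥M) → extension-theorem h n≡2h t (e ∷ M) (e-edge ∷ proj₁ mat , e∥M ∷ proj₂ mat)
                          (suc d) k (cong suc |M|≡d) (trans (NP.+-suc t d) t+d≡k) k≤h)
  inductionStep : DerivEq n k viaStep viaIH
  inductionStep = derivScale r {F = sumₚ (map (extendBy M) AE)} {sumₚ (map (extendSum M k r′) AE)}
    (derivSum AE (extendBy M) (extendSum M k r′) extended)
  k-split : ι k ≡ ι (k ∸ d) +q ι d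
  k-split = trans (cong ι (sym (NP.m∸n+n≡m (NP.<⇒≤ d<k)))) (ι-+ (k ∸ d) d)
  counted : ∀ m → coeff viaIH m ≡ coeff target m
  counted m = begin
      coeff viaIH m
        ≡⟨ trans (coeff-scale r (sumₚ (map (extendSum M k r′) AE)) m)
                 (cong (r *q_) (double-count M d k (k ∸ d) mat |M|≡d k-split r′ m)) ⟩
      r *q ((r′ *q ι (k ∸ d)) *q coeff (extSum n M k) m)
        ≡⟨ trans (sym (QP.*-assoc r (r′ *q ι (k ∸ d)) _))
                 (cong (_*q coeff (extSum n M k) m) (trans (sym (QP.*-assoc r r′ (ι (k ∸ d)))) (step-scalar h d k d<k k≤h))) ⟩
      recip ((h ∸ d) C (k ∸ d)) *q coeff (extSum n M k) m
        ≡⟨ sym (coeff-scale (recip ((h ∸ d) C (k ∸ d))) (extSum n M k) m) ⟩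
      coeff target m ∎
    where open ≡-Reasoning

-- the theorem
mainTheorem9 : (n h : ℕ) → n ≡ 2 * h → 1 ≤ h →
    (M : List (Edge n)) → IsMatching M →
    (d k : ℕ) → length M ≡ d → d ≤ k → k ≤ h →
    DerivEq n k (xM M) (scale (recip ((h ∸ d) C (k ∸ d))) (extSum n M k))
mainTheorem9 n h n≡2h _ M mat d k |M|≡d d≤k k≤h =
  extension-theorem h n≡2h (k ∸ d) M mat d k |M|≡d (NP.m∸n+n≡m d≤k) k≤h
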